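{- Fix $n$ and $p$ with $0\le p\le n/2$, and let $q>0$ be such that $\Delta_k(q)\ne 0$ for $0\le k\le n$. If a half-diagram $\mathfrak{a}$ on $n$ points with $p$ pairs has a slope at $i$ ($1\le i\le n-1$), then $e_i\,\xi'_{\mathfrak{a}}=0$.
   Context: Temperley–Lieb algebra: $TL_n$ is the complex vector space with basis $e_{\mathfrak{p}}$ indexed by noncrossing pairings $\mathfrak{p}$ of $\{1,\dots,2n\}$, drawn with points $1,\dots,n$ top to bottom on the left of a rectangle and $n+1,\dots,2n$ bottom to top on the right; products are by concatenation (identify point $2n-i+1$ of the first with point $i$ of the second, each closed loop contributing a factor $q$). The generator $e_i$ ($1\le i\le n-1$) pairs $i$ with $i+1$, $2n-i+1$ with $2n-i$, and every other $j\le n$ with $2n-j+1$. Half-diagrams: a half-diagram on $n$ points is a noncrossing partition of $\{1,\dots,n\}$ into pairs and singletons (singletons carry through-strings; noncrossing means no $i<k<j<l$ with $i\sim j,k\sim l$ and no $i<k<j$ with $i\sim j$, $k$ a singleton). $U(n)$ has basis $\xi_{\mathfrak{a}}$ over half-diagrams. $TL_n$ acts on $U(n)$: for a pairing $\mathfrak{p}$ and half-diagram $\mathfrak{a}$, identify point $i$ of $\mathfrak{a}$ with point $2n-i+1$ of $\mathfrak{p}$; if an edge path joins two through-strings of $\mathfrak{a}$ the result is $0$; otherwise $e_{\mathfrak{p}}\xi_{\mathfrak{a}}=q^c\xi_{\mathfrak{b}}$ where $c$ is the number of closed loops and $\mathfrak{b}$ is the half-diagram induced on points $1,\dots,n$ of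 $\mathfrak{p}$ by following edge paths (a point joined to a through-string of $\mathfrak{a}$ carries a through-string). Heights: $h_0(\mathfrak{a})=0$, $h_i(\mathfrak{a})$ = #$\{j\le i$: $j$ a through-string or paired with a larger point$\}$ − #$\{j\le i$: $j$ paired with a smaller point$\}$; a half-diagram is determined by its heights. For $1\le i\le n-1$: $\mathfrak{a}$ has a minimum at $i$ if $h_{i-1}>h_i<h_{i+1}$, a maximum if $h_{i-1}<h_i>h_{i+1}$, and a slope if $h_i$ lies strictly between $h_{i-1}$ and $h_{i+1}$. If $\mathfrak{a}$ has a minimum at $i$, $\Diamond_i(\mathfrak{a})$ is the half-diagram with the same heights except $h_i$ increased by $2$. Chebyshev polynomials: $\Delta_{ -1}=0$, $\Delta_0=1$, $\Delta_{k+1}(q)=q\Delta_k(q)-\Delta_{k-1}(q)$; $\mu_k=\Delta_{k-1}(q)/\Delta_k(q)$. Second basis: the minimal element $(1,\dots,1)$ with $p$ pairs is the half-diagram with pairs $\{1,2\},\dots,\{2p-1,2p\}$ and through-strings at $2p+1,\dots,n$; every half-diagram with $p$ pairs arises from it by a finite sequence of box additions. Set $\xi'_{(1,\dots,1)}=\xi_{(1,\dots,1)}$ and, whenever $\mathfrak{a}$ has a minimum at $i$, $\xi'_{\Diamond_i(\mathfrak{a})}=(e_i-\mu_{h_i(\mathfrak{a})+1})\xi'_{\mathfrak{a}}$ (independent of the chosen sequence of box additions). -}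

module Defs where

open import Level using (Level; _⊔_) renaming (suc to lsuc)
open import Algebra.Bundles using (CommutativeRing)
open import Data.Nat as ℕ using (ℕ; zero; suc; _≤_; _<_; _<ᵇ_)
open import Data.Integer as ℤ using (ℤ; ∣_∣) renaming (_+_ to _+ℤ_; _<_ to _<ℤ_)
open import Data.Bool using (Bool; true; false; if_then_else_)
open import Data.Maybe using (Maybe; just; nothing)
import Data.Maybe as Maybe
import Data.Maybe.Properties as MaybeP
open import Data.List using (List; []; _∷_; _++_; map; foldr; replicate; concatMap)
import Data.List.Properties as ListP
open import Data.Product using (_×_; _,_)
open import Data.Sum using (_⊎_)
open import Data.Empty using (⊥)
open import Relation.Nullary using (¬_; yes; no; Dec)
open import Relation.Binary.PropositionalEquality using (_≡_)

-- Fields (agda-stdlib has no Field bundle): a commutative ring with a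
-- total inverse function that is a genuine inverse on nonzero elements.

record Field (c ℓ : Level) : Set (lsuc (c ⊔ ℓ)) where
  field
    commutativeRing : CommutativeRing c ℓ
  open CommutativeRing commutativeRing public
  field
    _⁻¹       : Carrier → Carrier
    ⁻¹-inverse : ∀ x → ¬ (x ≈ 0#) → (x * (x ⁻¹)) ≈ 1#
    0≉1       : ¬ (0# ≈ 1#)

-- Half-diagrams on n points.  A candidate half-diagram is a list whose
-- (j-1)-th entry describes point j (1-based): nothing = through-string,
-- just k = paired with point k.

Diagram : Set
Diagram = List (Maybe ℕ)

-- partner of point j (1-based); out of range gives nothing
pt : Diagram → ℕ → Maybe ℕ
pt []       _             = nothing
pt (x ∷ xs) zero          = nothing
pt (x ∷ xs) (suc zero)    = x
pt (x ∷ xs) (suc (suc j)) = pt xs (suc j)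

setPt : Diagram → ℕ → Maybe ℕ → Diagram
setPt []       _             v = []
setPt (x ∷ xs) zero          v = x ∷ xs
setPt (x ∷ xs) (suc zero)    v = v ∷ xs
setPt (x ∷ xs) (suc (suc j)) v = x ∷ setPt xs (suc j) v

-- noncrossing partition of {1..n} into pairs and singletons
record IsHalfDiagram (n : ℕ) (a : Diagram) : Set where
  field
    len        : Data.List.length a ≡ n
    pairing    : ∀ j k → 1 ≤ j → j ≤ n → pt a j ≡ just k →
                 (1 ≤ k) × (k ≤ n) × ¬ (k ≡ j) × (pt a k ≡ just j)
    noCross    : ∀ i j k l → pt a i ≡ just j → pt a k ≡ just l →
                 i < k → k < j → j < l → ⊥
    noEnclosed : ∀ i j k → 1 ≤ i → pt a i ≡ just j → i < k → k < j →
                 pt a k ≡ nothing → ⊥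

-- the minimal element (1,...,1) with p pairs on n points:
-- pairs {1,2},...,{2p-1,2p}, through-strings at 2p+1,...,n  (needs 2p ≤ n)
minimal : ℕ → ℕ → Diagram
minimal zero          n             = replicate n nothing
minimal (suc p)       (suc (suc m)) =
  just 2 ∷ just 1 ∷ map (Maybe.map (λ k → 2 ℕ.+ k)) (minimal p m)
minimal (suc p)       _             = []

step : Diagram → ℕ → ℤ
step a j with pt a j
... | nothing = ℤ.+ 1
... | just k  = if j <ᵇ k then ℤ.+ 1 else ℤ.- (ℤ.+ 1)

height : Diagram → ℕ → ℤ
height a zero    = ℤ.+ 0
height a (suc m) = height a m +ℤ step a (suc m)

MinimumAt : Diagram → ℕ → Set
MinimumAt a i = (height a i <ℤ height a (i ℕ.∸ 1)) × (height a i <ℤ height a (suc i))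

SlopeAt : Diagram → ℕ → Set
SlopeAt a i =
    ((height a (i ℕ.∸ 1) <ℤ height a i) × (height a i <ℤ height a (suc i)))
  ⊎ ((height a (suc i) <ℤ height a i) × (height a i <ℤ height a (i ℕ.∸ 1)))

BoxAdd : ℕ → ℕ → Diagram → Diagram → Set
BoxAdd n i a b =
  (1 ≤ i) × (suc i ≤ n) × MinimumAt a i × IsHalfDiagram n b ×
  (height b i ≡ height a i +ℤ ℤ.+ 2) ×
  (∀ m → ¬ (m ≡ i) → height b m ≡ height a m)

_≟D_ : (a b : Diagram) → Dec (a ≡ b)
_≟D_ = ListP.≡-dec (MaybeP.≡-dec ℕ._≟_)

module TL {c ℓ : Level} (F : Field c ℓ) (q : Field.Carrier F) where
  open Field F

  -- Chebyshev polynomials evaluated at q: Δ k = Δ_k(q)  (Δ_{-1} = 0)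
  Δ : ℕ → Carrier
  Δ zero          = 1#
  Δ (suc zero)    = q
  Δ (suc (suc k)) = (q * Δ (suc k)) - Δ k

  μ : ℕ → Carrier
  μ zero    = 0#
  μ (suc k) = Δ k * (Δ (suc k) ⁻¹)

  -- formal linear combinations Σ c_b ξ_b  (elements of U(n))
  LC : Set c
  LC = List (Carrier × Diagram)

  coeff : LC → Diagram → Carrier
  coeff []             b = 0#
  coeff ((x , d) ∷ xs) b with d ≟D b
  ... | yes _ = x + coeff xs b
  ... | no  _ = coeff xs b

  scale : Carrier → LC → LC
  scale x = map (λ { (y , d) → (x * y , d) })

  -- action of the generator e_i on a basis vector ξ_a:
  -- concatenating the diagram of e_i with a (cup at points i,i+1 of a)
  eBasis : ℕ → Carrier → Diagram → LC
  eBasis i x a with pt a i | pt a (suc i)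
  ... | nothing | nothing = []
  ... | nothing | just k  =
        (x , setPt (setPt (setPt a k nothing) i (just (suc i))) (suc i) (just i)) ∷ []
  ... | just j  | nothing =
        (x , setPt (setPt (setPt a j nothing) i (just (suc i))) (suc i) (just i)) ∷ []
  ... | just j  | just k with j ℕ.≟ suc i
  ...   | yes _ = (q * x , a) ∷ []
  ...   | no  _ =
        (x , setPt (setPt (setPt (setPt a j (just k)) k (just j)) i (just (suc i))) (suc i) (just i)) ∷ []

  eAct : ℕ → LC → LC
  eAct i = concatMap (λ { (x , a) → eBasis i x a })

  eMinus : ℕ → Carrier → LC → LC
  eMinus i m v = eAct i v ++ scale (- m) v

  -- XiPrime n p a v : v is ξ'_a, obtained from ξ_{(1,...,1)} (p pairs, n
  -- points) by a sequence of box additions ξ'_{◇_i a} = (e_i - μ_{h_i(a)+1}) ξ'_a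
  data XiPrime (n p : ℕ) : Diagram → LC → Set (c ⊔ ℓ) where
    base : XiPrime n p (minimal p n) ((1# , minimal p n) ∷ [])
    box  : ∀ {a b v} i → XiPrime n p a v → BoxAdd n i a b →
           XiPrime n p b (eMinus i (μ (suc ∣ height a i ∣)) v)

  IsZero : LC → Set ℓ
  IsZero v = ∀ b → coeff v b ≈ 0#

module Submission where

-- Proof idea.  ξ′_a arises from ξ_{(1,…,1)} by box additions
-- v = (e_k - μ) v₀; induct on their number.  A box at i would create a peak,
-- not a slope.  A box at distance ≥ 2 commutes with e_i, and the slope is
-- already present before it.  A box next to i sits beside a peak of height
-- x+1 of the previous heights: if x = 0 that peak is a cup that no box
-- touches, so e_i v₀ = q v₀; if x > 0 the peak may be taken to be the last
-- box added (distant boxes commute), v₀ = (e_i - μ′) v₁ with a slope of v₁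
-- at k.  In both cases the Temperley–Lieb relations together with the
-- Chebyshev recurrence μ_{x+1} (q - μ_x) = 1 give e_i (e_k - μ) v₀ = 0.

open import Defs
open import Level using (Level; _⊔_)
open import Data.Nat as ℕ using (ℕ; zero; suc; _≤_; _<_; z≤n; s≤s; _≟_)
open import Data.Nat.Properties using (suc-injective; 1+n≢n; ≤-trans; ≤-refl; n≤1+n)
open import Data.Maybe using (Maybe; just; nothing)
open import Data.Maybe.Properties using (just-injective)
open import Data.List using ([]; _∷_; length; _++_; map)
import Data.List.Properties as List
open import Data.List.Relation.Unary.All as All using (All)
import Data.List.Relation.Unary.All.Properties as All
open import Data.Product using (Σ; _×_; _,_; proj₁; proj₂)
open import Data.Sum using (_⊎_; inj₁; inj₂)
open import Data.Empty using (⊥; ⊥-elim)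
open import Relation.Nullary using (¬_; yes; no)
open import Relation.Binary.PropositionalEquality as ≡ using (_≡_; _≢_)
open import Function using (_∘_)

just≢nothing : ∀ {w : ℕ} → just w ≢ nothing
just≢nothing ()

n≢2+n : ∀ {n} → n ≢ suc (suc n)
n≢2+n {zero} ()
n≢2+n {suc n} e = n≢2+n (suc-injective e)

module _ where
  open ≡

  pt-zero : ∀ a → pt a 0 ≡ nothing
  pt-zero []      = refl
  pt-zero (x ∷ a) = refl

  pt-setPt-same : ∀ a j v → 1 ≤ j → j ≤ length a → pt (setPt a j v) j ≡ v
  pt-setPt-same (x ∷ a) (suc zero)    v _ _       = refl
  pt-setPt-same (x ∷ a) (suc (suc j)) v _ (s≤s p) = pt-setPt-same a (suc j) v (s≤s z≤n) p

  pt-setPt-other : ∀ a j v y → y ≢ j → pt (setPt a j v) y ≡ pt a y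
  pt-setPt-other []      j             v y             ne = refl
  pt-setPt-other (x ∷ a) zero          v y             ne = refl
  pt-setPt-other (x ∷ a) (suc zero)    v zero          ne = refl
  pt-setPt-other (x ∷ a) (suc zero)    v (suc zero)    ne = ⊥-elim (ne refl)
  pt-setPt-other (x ∷ a) (suc zero)    v (suc (suc y)) ne = refl
  pt-setPt-other (x ∷ a) (suc (suc j)) v zero          ne = refl
  pt-setPt-other (x ∷ a) (suc (suc j)) v (suc zero)    ne = refl
  pt-setPt-other (x ∷ a) (suc (suc j)) v (suc (suc y)) ne =
    pt-setPt-other a (suc j) v (suc y) (λ e → ne (cong suc e))

  length-setPt : ∀ a j v → length (setPt a j v) ≡ length a
  length-setPt []      j             v = refl
  length-setPt (x ∷ a) zero          v = refl
  length-setPt (x ∷ a) (suc zero)    v = refl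
  length-setPt (x ∷ a) (suc (suc j)) v = cong suc (length-setPt a (suc j) v)

  diagram-ext : ∀ a b → length a ≡ length b → (∀ j → pt a j ≡ pt b j) → a ≡ b
  diagram-ext []      []      _ _ = refl
  diagram-ext (x ∷ a) (y ∷ b) l h = cong₂ _∷_ (h 1) (diagram-ext a b (suc-injective l) h′)
    where
    h′ : ∀ j → pt a j ≡ pt b j
    h′ zero    = trans (pt-zero a) (sym (pt-zero b))
    h′ (suc j) = h (suc (suc j))

  pt-just⇒inRange : ∀ a j k → pt a j ≡ just k → (1 ≤ j) × (j ≤ length a)
  pt-just⇒inRange (x ∷ a) (suc zero)    k e = s≤s z≤n , s≤s z≤n
  pt-just⇒inRange (x ∷ a) (suc (suc j)) k e = s≤s z≤n , s≤s (proj₂ (pt-just⇒inRange a (suc j) k e))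

-- The generator e_i turns the partner function f of a
-- basis diagram into eFn i f: the points i and i+1 become partners (the new
-- cup), and a strand that used to end at i or i+1 is rerouted through the
-- cap of e_i to the old partner of i+1 or i respectively (`follow`).  Both
-- functions are kept abstract so that all reasoning goes through the
-- defining equations below rather than through unfolded `with` clauses.
PartnerFn : Set
PartnerFn = ℕ → Maybe ℕ

abstract
  follow : ℕ → PartnerFn → Maybe ℕ → Maybe ℕ
  follow i f nothing = nothing
  follow i f (just z) with z ≟ i | z ≟ suc i
  ... | yes _ | _     = f (suc i)
  ... | no _  | yes _ = f i
  ... | no _  | no _  = just z

  eFn : ℕ → PartnerFn → PartnerFn
  eFn i f y with y ≟ i | y ≟ suc i
  ... | yes _ | _     = just (suc i)
  ... | no _  | yes _ = just i
  ... | no _  | no _  = follow i f (f y)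

  follow-nothing : ∀ i f → follow i f nothing ≡ nothing
  follow-nothing i f = ≡.refl

  follow-i : ∀ i f → follow i f (just i) ≡ f (suc i)
  follow-i i f with i ≟ i
  ... | yes _ = ≡.refl
  ... | no ne = ⊥-elim (ne ≡.refl)

  follow-suc : ∀ i f → follow i f (just (suc i)) ≡ f i
  follow-suc i f with suc i ≟ i | suc i ≟ suc i
  ... | yes e | _     = ⊥-elim (1+n≢n e)
  ... | no _  | yes _ = ≡.refl
  ... | no _  | no ne = ⊥-elim (ne ≡.refl)

  follow-other : ∀ i f z → z ≢ i → z ≢ suc i → follow i f (just z) ≡ just z
  follow-other i f z n₁ n₂ with z ≟ i | z ≟ suc i
  ... | yes e | _     = ⊥-elim (n₁ e)
  ... | no _  | yes e = ⊥-elim (n₂ e)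
  ... | no _  | no _  = ≡.refl

  eFn-i : ∀ i f → eFn i f i ≡ just (suc i)
  eFn-i i f with i ≟ i
  ... | yes _ = ≡.refl
  ... | no ne = ⊥-elim (ne ≡.refl)

  eFn-suc : ∀ i f → eFn i f (suc i) ≡ just i
  eFn-suc i f with suc i ≟ i | suc i ≟ suc i
  ... | yes e | _     = ⊥-elim (1+n≢n e)
  ... | no _  | yes _ = ≡.refl
  ... | no _  | no ne = ⊥-elim (ne ≡.refl)

  eFn-other : ∀ i f y → y ≢ i → y ≢ suc i → eFn i f y ≡ follow i f (f y)
  eFn-other i f y n₁ n₂ with y ≟ i | y ≟ suc i
  ... | yes e | _     = ⊥-elim (n₁ e)
  ... | no _  | yes e = ⊥-elim (n₂ e)
  ... | no _  | no _  = ≡.refl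

module _ where
  open ≡

  follow-id : ∀ k g m → m ≢ just k → m ≢ just (suc k) → follow k g m ≡ m
  follow-id k g nothing  _  _  = follow-nothing k g
  follow-id k g (just z) n₁ n₂ = follow-other k g z (λ e → n₁ (cong just e)) (λ e → n₂ (cong just e))

  follow-agree : ∀ k {f h : PartnerFn} w → (w ≡ just k → f (suc k) ≡ h (suc k)) →
                 (w ≡ just (suc k) → f k ≡ h k) → follow k f w ≡ follow k h w
  follow-agree k nothing _ _ = trans (follow-nothing k _) (sym (follow-nothing k _))
  follow-agree k {f} {h} (just z) p₁ p₂ with z ≟ k
  ... | yes refl = trans (follow-i z f) (trans (p₁ refl) (sym (follow-i z h)))
  ... | no z≢k with z ≟ suc k
  ... | yes refl = trans (follow-suc k f) (trans (p₂ refl) (sym (follow-suc k h)))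
  ... | no z≢sk = trans (follow-other k f z z≢k z≢sk) (sym (follow-other k h z z≢k z≢sk))

  eFn-through : ∀ {f : PartnerFn} i u → u ≢ i → u ≢ suc i → f u ≡ nothing → eFn i f u ≡ nothing
  eFn-through {f} i u n₁ n₂ e = trans (eFn-other i f u n₁ n₂) (trans (cong (follow i f) e) (follow-nothing i f))

  eFn-away : ∀ {f : PartnerFn} i u → u ≢ i → u ≢ suc i → f u ≢ just i → f u ≢ just (suc i) →
             eFn i f u ≡ f u
  eFn-away {f} i u n₁ n₂ n₃ n₄ = trans (eFn-other i f u n₁ n₂) (follow-id i f (f u) n₃ n₄)

  eFn-cong : ∀ i {f g : PartnerFn} → (∀ y → f y ≡ g y) → ∀ y → eFn i f y ≡ eFn i g y
  eFn-cong i {f} {g} h y with y ≟ i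
  ... | yes refl = trans (eFn-i y f) (sym (eFn-i y g))
  ... | no y≢i with y ≟ suc i
  ... | yes refl = trans (eFn-suc i f) (sym (eFn-suc i g))
  ... | no y≢si = trans (eFn-other i f y y≢i y≢si)
                   (trans (cong (follow i f) (h y))
                   (trans (follow-agree i (g y) (λ _ → h (suc i)) (λ _ → h i))
                          (sym (eFn-other i g y y≢i y≢si))))

module Pairing {f : PartnerFn} (f-sym : ∀ j k → f j ≡ just k → f k ≡ just j)
               (f-irr : ∀ j → f j ≢ just j) where
  open ≡

  partner-unique : ∀ j k l → f j ≡ just k → f l ≡ just k → j ≡ l
  partner-unique j k l e₁ e₂ = just-injective (trans (sym (f-sym j k e₁)) (f-sym l k e₂))

  partner-back : ∀ {u v w} → f u ≡ just v → f v ≡ just w → w ≡ u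
  partner-back e₁ e₂ = just-injective (trans (sym e₂) (f-sym _ _ e₁))

  follow-back : ∀ i y w → y ≢ i → y ≢ suc i → follow i f (f y) ≡ just w → eFn i f w ≡ just y
  follow-back i y w y≢i y≢si = go (f y) refl
    where
    go : ∀ m → f y ≡ m → follow i f m ≡ just w → eFn i f w ≡ just y
    go nothing _ e = ⊥-elim (just≢nothing (trans (sym e) (follow-nothing i f)))
    go (just z) ez e with z ≟ i
    ... | yes refl = via-suc (f (suc z)) refl (trans (sym (follow-i z f)) e)
      where
      via-suc : ∀ m → f (suc z) ≡ m → m ≡ just w → eFn z f w ≡ just y
      via-suc nothing _ ()
      via-suc (just k) ek refl with k ≟ z
      ... | yes refl = ⊥-elim (y≢si (partner-unique _ _ _ ez ek))
      ... | no k≢z with k ≟ suc z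
      ... | yes refl = ⊥-elim (f-irr _ ek)
      ... | no k≢sz = trans (eFn-other z f k k≢z k≢sz)
                       (trans (cong (follow z f) (f-sym _ _ ek)) (trans (follow-suc z f) (f-sym _ _ ez)))
    ... | no z≢i with z ≟ suc i
    ... | yes refl = via-i (f i) refl (trans (sym (follow-suc i f)) e)
      where
      via-i : ∀ m → f i ≡ m → m ≡ just w → eFn i f w ≡ just y
      via-i nothing _ ()
      via-i (just k) ek refl with k ≟ suc i
      ... | yes refl = ⊥-elim (y≢i (partner-unique _ _ _ ez ek))
      ... | no k≢si with k ≟ i
      ... | yes refl = ⊥-elim (f-irr _ ek)
      ... | no k≢i = trans (eFn-other i f k k≢i k≢si)
                      (trans (cong (follow i f) (f-sym _ _ ek)) (trans (follow-i i f) (f-sym _ _ ez)))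
    ... | no z≢si with trans (sym (follow-other i f z z≢i z≢si)) e
    ... | refl = trans (eFn-other i f z z≢i z≢si)
                   (trans (cong (follow i f) (f-sym _ _ ez)) (follow-other i f y y≢i y≢si))

  eFn-symmetric : ∀ i y w → eFn i f y ≡ just w → eFn i f w ≡ just y
  eFn-symmetric i y w e with y ≟ i
  ... | yes refl = trans (cong (eFn i f) (just-injective (trans (sym e) (eFn-i i f)))) (eFn-suc i f)
  ... | no y≢i with y ≟ suc i
  ... | yes refl = trans (cong (eFn i f) (just-injective (trans (sym e) (eFn-suc i f)))) (eFn-i i f)
  ... | no y≢si = follow-back i y w y≢i y≢si (trans (sym (eFn-other i f y y≢i y≢si)) e)

  eFn-irreflexive : ∀ i y → eFn i f y ≢ just y
  eFn-irreflexive i y e with y ≟ i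
  ... | yes refl = 1+n≢n (just-injective (trans (sym (eFn-i y f)) e))
  ... | no y≢i with y ≟ suc i
  ... | yes refl = 1+n≢n (sym (just-injective (trans (sym (eFn-suc i f)) e)))
  ... | no y≢si = go (f y) refl (trans (sym (eFn-other i f y y≢i y≢si)) e)
    where
    go : ∀ m → f y ≡ m → follow i f m ≡ just y → ⊥
    go nothing _ e₂ = just≢nothing (trans (sym e₂) (follow-nothing i f))
    go (just z) ez e₂ with z ≟ i
    ... | yes refl = 1+n≢n (sym (just-injective (trans (sym ez) (f-sym _ _ (trans (sym (follow-i z f)) e₂)))))
    ... | no z≢i with z ≟ suc i
    ... | yes refl = 1+n≢n (just-injective (trans (sym ez) (f-sym _ _ (trans (sym (follow-suc i f)) e₂))))
    ... | no z≢si = f-irr y (trans ez (trans (sym (follow-other i f z z≢i z≢si)) e₂))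

  eFn-cup : ∀ i → f i ≡ just (suc i) → ∀ y → eFn i f y ≡ f y
  eFn-cup i e y with y ≟ i
  ... | yes refl = trans (eFn-i y f) (sym e)
  ... | no y≢i with y ≟ suc i
  ... | yes refl = trans (eFn-suc i f) (sym (f-sym _ _ e))
  ... | no y≢si = trans (eFn-other i f y y≢i y≢si)
                   (follow-id i f (f y) (λ e₂ → y≢si (sym (partner-back e₂ e)))
                                        (λ e₂ → y≢i (sym (partner-back e₂ (f-sym _ _ e)))))

  eFn-zigzag↑ : ∀ i → f (suc i) ≡ just (suc (suc i)) → ∀ y → eFn (suc i) (eFn i f) y ≡ f y
  eFn-zigzag↑ i e y with y ≟ suc i
  ... | yes refl = trans (eFn-i (suc i) (eFn i f)) (sym e)
  ... | no y≢s with y ≟ suc (suc i)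
  ... | yes refl = trans (eFn-suc (suc i) (eFn i f)) (sym (f-sym _ _ e))
  ... | no y≢t with y ≟ i
  ... | yes refl = trans (eFn-other (suc y) (eFn y f) y (λ e → 1+n≢n (sym e)) n≢2+n)
                   (trans (cong (follow (suc y) (eFn y f)) (eFn-i y f))
                   (trans (follow-i (suc y) (eFn y f))
                   (trans (eFn-other y f (suc (suc y)) (λ e → n≢2+n (sym e)) 1+n≢n)
                   (trans (cong (follow y f) (f-sym _ _ e)) (follow-suc y f)))))
  ... | no y≢i = trans (eFn-other (suc i) (eFn i f) y y≢s y≢t)
                 (trans (cong (follow (suc i) (eFn i f)) (eFn-other i f y y≢i y≢s)) (go (f y) refl))
    where
    go : ∀ m → f y ≡ m → follow (suc i) (eFn i f) (follow i f m) ≡ m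
    go nothing _ = trans (cong (follow (suc i) (eFn i f)) (follow-nothing i f)) (follow-nothing (suc i) (eFn i f))
    go (just z) ez with z ≟ i
    ... | yes refl = trans (cong (follow (suc z) (eFn z f)) (trans (follow-i z f) e))
                           (trans (follow-suc (suc z) (eFn z f)) (eFn-suc z f))
    ... | no z≢i with z ≟ suc i
    ... | yes refl = ⊥-elim (y≢t (sym (partner-back ez e)))
    ... | no z≢s with z ≟ suc (suc i)
    ... | yes refl = ⊥-elim (y≢s (sym (partner-back ez (f-sym _ _ e))))
    ... | no z≢t = trans (cong (follow (suc i) (eFn i f)) (follow-other i f z z≢i z≢s))
                         (follow-other (suc i) (eFn i f) z z≢s z≢t)

  eFn-zigzag↓ : ∀ i → f i ≡ just (suc i) → ∀ y → eFn i (eFn (suc i) f) y ≡ f y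
  eFn-zigzag↓ i e y with y ≟ i
  ... | yes refl = trans (eFn-i y (eFn (suc y) f)) (sym e)
  ... | no y≢i with y ≟ suc i
  ... | yes refl = trans (eFn-suc i (eFn (suc i) f)) (sym (f-sym _ _ e))
  ... | no y≢s with y ≟ suc (suc i)
  ... | yes refl = trans (eFn-other i (eFn (suc i) f) (suc (suc i)) (λ e → n≢2+n (sym e)) 1+n≢n)
                   (trans (cong (follow i (eFn (suc i) f)) (eFn-suc (suc i) f))
                   (trans (follow-suc i (eFn (suc i) f))
                   (trans (eFn-other (suc i) f i (λ e → 1+n≢n (sym e)) n≢2+n)
                   (trans (cong (follow (suc i) f) e) (follow-i (suc i) f)))))
  ... | no y≢t = trans (eFn-other i (eFn (suc i) f) y y≢i y≢s)
                 (trans (cong (follow i (eFn (suc i) f)) (eFn-other (suc i) f y y≢s y≢t)) (go (f y) refl))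
    where
    go : ∀ m → f y ≡ m → follow i (eFn (suc i) f) (follow (suc i) f m) ≡ m
    go nothing _ = trans (cong (follow i (eFn (suc i) f)) (follow-nothing (suc i) f)) (follow-nothing i (eFn (suc i) f))
    go (just z) ez with z ≟ suc i
    ... | yes refl = ⊥-elim (y≢i (sym (partner-back ez (f-sym _ _ e))))
    ... | no z≢s with z ≟ suc (suc i)
    ... | yes refl = trans (cong (follow i (eFn (suc i) f)) (trans (follow-suc (suc i) f) (f-sym _ _ e)))
                           (trans (follow-i i (eFn (suc i) f)) (eFn-i (suc i) f))
    ... | no z≢t with z ≟ i
    ... | yes refl = ⊥-elim (y≢s (sym (partner-back ez e)))
    ... | no z≢i = trans (cong (follow i (eFn (suc i) f)) (follow-other (suc i) f z z≢s z≢t))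
                         (follow-other i (eFn (suc i) f) z z≢i z≢s)

  module Distant (i k : ℕ) (i≢k : i ≢ k) (i≢sk : i ≢ suc k) (k≢si : k ≢ suc i) where
    si≢sk : suc i ≢ suc k
    si≢sk e = i≢k (suc-injective e)

    private
      g h : PartnerFn
      g = eFn k f
      h = eFn i f

      h-at-sk : f (suc k) ≢ just i → f (suc k) ≢ just (suc i) → f (suc k) ≡ h (suc k)
      h-at-sk n₁ n₂ = sym (eFn-away i (suc k) (≢-sym i≢sk) (≢-sym si≢sk) n₁ n₂)
      h-at-k : f k ≢ just i → f k ≢ just (suc i) → f k ≡ h k
      h-at-k n₁ n₂ = sym (eFn-away i k (≢-sym i≢k) k≢si n₁ n₂)
      g-at-si : f (suc i) ≢ just k → f (suc i) ≢ just (suc k) → f (suc i) ≡ g (suc i)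
      g-at-si n₁ n₂ = sym (eFn-away k (suc i) (≢-sym k≢si) si≢sk n₁ n₂)
      g-at-i : f i ≢ just k → f i ≢ just (suc k) → f i ≡ g i
      g-at-i n₁ n₂ = sym (eFn-away k i i≢k i≢sk n₁ n₂)

      follow-commute : ∀ y → y ≢ i → y ≢ suc i → y ≢ k → y ≢ suc k → ∀ m → f y ≡ m →
                       follow i g (follow k f m) ≡ follow k h (follow i f m)
      follow-commute y n₁ n₂ n₃ n₄ nothing _ =
        trans (cong (follow i g) (follow-nothing k f))
          (trans (follow-nothing i g) (sym (trans (cong (follow k h) (follow-nothing i f)) (follow-nothing k h))))
      follow-commute y n₁ n₂ n₃ n₄ (just z) ez with z ≟ i
      ... | yes refl =
        trans (cong (follow z g) (follow-other k f z i≢k i≢sk))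
          (trans (follow-i z g) (trans (eFn-other k f (suc z) (≢-sym k≢si) si≢sk)
          (trans (follow-agree k (f (suc z))
                   (λ ew → h-at-sk (λ e → n₄ (partner-back e (f-sym _ _ ez))) (λ e → 1+n≢n (sym (partner-back e ew))))
                   (λ ew → h-at-k (λ e → n₃ (partner-back e (f-sym _ _ ez))) (λ e → 1+n≢n (partner-back e ew))))
                 (sym (cong (follow k h) (follow-i z f))))))
      ... | no z≢i with z ≟ suc i
      ... | yes refl =
        trans (cong (follow i g) (follow-other k f (suc i) (≢-sym k≢si) si≢sk))
          (trans (follow-suc i g) (trans (eFn-other k f i i≢k i≢sk)
          (trans (follow-agree k (f i)
                   (λ ew → h-at-sk (λ e → 1+n≢n (sym (partner-back e ew))) (λ e → n₄ (partner-back e (f-sym _ _ ez))))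
                   (λ ew → h-at-k (λ e → 1+n≢n (partner-back e ew)) (λ e → n₃ (partner-back e (f-sym _ _ ez)))))
                 (sym (cong (follow k h) (follow-suc i f))))))
      ... | no z≢si with z ≟ k
      ... | yes refl =
        trans (cong (follow i g) (follow-i z f))
          (trans (follow-agree i (f (suc z))
                   (λ ew → sym (g-at-si (λ e → n₂ (partner-back e (f-sym _ _ ez))) (λ e → 1+n≢n (sym (partner-back e ew)))))
                   (λ ew → sym (g-at-i (λ e → n₁ (partner-back e (f-sym _ _ ez))) (λ e → 1+n≢n (partner-back e ew)))))
          (sym (trans (cong (follow z h) (follow-other i f z (≢-sym i≢k) k≢si))
                 (trans (follow-i z h) (eFn-other i f (suc z) (≢-sym i≢sk) (≢-sym si≢sk))))))
      ... | no z≢k with z ≟ suc k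
      ... | yes refl =
        trans (cong (follow i g) (follow-suc k f))
          (trans (follow-agree i (f k)
                   (λ ew → sym (g-at-si (λ e → 1+n≢n (sym (partner-back e ew))) (λ e → n₂ (partner-back e (f-sym _ _ ez)))))
                   (λ ew → sym (g-at-i (λ e → 1+n≢n (partner-back e ew)) (λ e → n₁ (partner-back e (f-sym _ _ ez))))))
          (sym (trans (cong (follow k h) (follow-other i f (suc k) (≢-sym i≢sk) (≢-sym si≢sk)))
                 (trans (follow-suc k h) (eFn-other i f k (≢-sym i≢k) k≢si)))))
      ... | no z≢sk =
        trans (cong (follow i g) (follow-other k f z z≢k z≢sk))
          (trans (follow-other i g z z≢i z≢si)
          (sym (trans (cong (follow k h) (follow-other i f z z≢i z≢si)) (follow-other k h z z≢k z≢sk))))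

    eFn-commute : ∀ y → eFn i g y ≡ eFn k h y
    eFn-commute y with y ≟ i
    ... | yes refl = trans (eFn-i y g) (sym (trans (eFn-other k h y i≢k i≢sk)
                       (trans (cong (follow k h) (eFn-i y f)) (follow-other k h (suc y) (≢-sym k≢si) si≢sk))))
    ... | no y≢i with y ≟ suc i
    ... | yes refl = trans (eFn-suc i g) (sym (trans (eFn-other k h (suc i) (≢-sym k≢si) si≢sk)
                       (trans (cong (follow k h) (eFn-suc i f)) (follow-other k h i i≢k i≢sk))))
    ... | no y≢si with y ≟ k
    ... | yes refl = trans (eFn-other i g y (≢-sym i≢k) k≢si)
                       (trans (cong (follow i g) (eFn-i y f))
                       (trans (follow-other i g (suc y) (≢-sym i≢sk) (≢-sym si≢sk)) (sym (eFn-i y h))))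
    ... | no y≢k with y ≟ suc k
    ... | yes refl = trans (eFn-other i g (suc k) (≢-sym i≢sk) (≢-sym si≢sk))
                       (trans (cong (follow i g) (eFn-suc k f))
                       (trans (follow-other i g k (≢-sym i≢k) k≢si) (sym (eFn-suc k h))))
    ... | no y≢sk = trans (eFn-other i g y y≢i y≢si)
                      (trans (cong (follow i g) (eFn-other k f y y≢k y≢sk))
                      (trans (follow-commute y y≢i y≢si y≢k y≢sk (f y) refl)
                             (sym (trans (eFn-other k h y y≢k y≢sk) (cong (follow k h) (eFn-other i f y y≢i y≢si))))))

    cup-kept : f k ≡ just (suc k) → h k ≡ just (suc k)
    cup-kept e = trans (eFn-away i k (≢-sym i≢k) k≢si (λ e₂ → i≢sk (sym (just-injective (trans (sym e) e₂))))
                                                        (λ e₂ → si≢sk (sym (just-injective (trans (sym e) e₂))))) e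

    cup-transfer : f i ≢ just (suc i) → g i ≡ just (suc i) → h k ≡ just (suc k)
    cup-transfer nc e = trans (eFn-other i f k (≢-sym i≢k) k≢si) (go (f i) refl (trans (sym (eFn-other k f i i≢k i≢sk)) e))
      where
      go : ∀ m → f i ≡ m → follow k f m ≡ just (suc i) → follow i f (f k) ≡ just (suc k)
      go nothing _ e₂ = ⊥-elim (just≢nothing (trans (sym e₂) (follow-nothing k f)))
      go (just z) ez e₂ with z ≟ k
      ... | yes refl = trans (cong (follow i f) (f-sym _ _ ez)) (trans (follow-i i f) (f-sym _ _ (trans (sym (follow-i z f)) e₂)))
      ... | no z≢k with z ≟ suc k
      ... | yes refl = trans (cong (follow i f) (trans (sym (follow-suc k f)) e₂)) (trans (follow-suc i f) ez)
      ... | no z≢sk = ⊥-elim (nc (trans ez (trans (sym (follow-other k f z z≢k z≢sk)) e₂)))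

    -- u becomes a through-string once the cap joining p and p' is followed
    ThroughAfterCap : ℕ → ℕ → ℕ → Set
    ThroughAfterCap u p p′ = (f u ≡ nothing) ⊎ ((f u ≡ just p × f p′ ≡ nothing) ⊎ (f u ≡ just p′ × f p ≡ nothing))

    through-swap : ∀ {u p p′} → ThroughAfterCap u p p′ → ThroughAfterCap u p′ p
    through-swap (inj₁ x)        = inj₁ x
    through-swap (inj₂ (inj₁ x)) = inj₂ (inj₂ x)
    through-swap (inj₂ (inj₂ x)) = inj₂ (inj₁ x)

    through-k : ∀ u → follow k f (f u) ≡ nothing → ThroughAfterCap u k (suc k)
    through-k u = go (f u) refl
      where
      go : ∀ m → f u ≡ m → follow k f m ≡ nothing → ThroughAfterCap u k (suc k)
      go nothing ez _ = inj₁ ez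
      go (just z) ez e₂ with z ≟ k
      ... | yes refl = inj₂ (inj₁ (ez , trans (sym (follow-i z f)) e₂))
      ... | no z≢k with z ≟ suc k
      ... | yes refl = inj₂ (inj₂ (ez , trans (sym (follow-suc k f)) e₂))
      ... | no z≢sk = ⊥-elim (just≢nothing (trans (sym (follow-other k f z z≢k z≢sk)) e₂))

    through-transfer : ∀ p p′ → ThroughAfterCap i p p′ → ThroughAfterCap (suc i) p p′ → p ≢ i → p ≢ suc i →
                       ¬ (f i ≡ nothing × f (suc i) ≡ nothing) → follow i f (f p) ≡ nothing
    through-transfer p p′ Ti Tsi p≢i p≢si both = go (f p) refl
      where
      go : ∀ m → f p ≡ m → follow i f m ≡ nothing
      go nothing _ = follow-nothing i f
      go (just z) ez with z ≟ i
      ... | yes refl = trans (follow-i z f) (at-si Tsi)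
        where
        at-si : ThroughAfterCap (suc z) p p′ → f (suc z) ≡ nothing
        at-si (inj₁ x)              = x
        at-si (inj₂ (inj₁ (e₁ , _))) = ⊥-elim (1+n≢n (just-injective (trans (sym (f-sym _ _ e₁)) ez)))
        at-si (inj₂ (inj₂ (_ , e₂))) = ⊥-elim (just≢nothing (trans (sym ez) e₂))
      ... | no z≢i with z ≟ suc i
      ... | yes refl = trans (follow-suc i f) (at-i Ti)
        where
        at-i : ThroughAfterCap i p p′ → f i ≡ nothing
        at-i (inj₁ x)              = x
        at-i (inj₂ (inj₁ (e₁ , _))) = ⊥-elim (1+n≢n (just-injective (trans (sym ez) (f-sym _ _ e₁))))
        at-i (inj₂ (inj₂ (_ , e₂))) = ⊥-elim (just≢nothing (trans (sym ez) e₂))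
      ... | no z≢si = ⊥-elim (both (at i Ti (≢-sym z≢i) , at (suc i) Tsi (≢-sym z≢si)))
        where
        at : ∀ u → ThroughAfterCap u p p′ → u ≢ z → f u ≡ nothing
        at u (inj₁ x)              _   = x
        at u (inj₂ (inj₁ (e₁ , _))) u≢z = ⊥-elim (u≢z (just-injective (trans (sym (f-sym _ _ e₁)) ez)))
        at u (inj₂ (inj₂ (_ , e₂))) _   = ⊥-elim (just≢nothing (trans (sym ez) e₂))

    through-strings-transfer : ¬ (f i ≡ nothing × f (suc i) ≡ nothing) → g i ≡ nothing → g (suc i) ≡ nothing →
                               (h k ≡ nothing) × (h (suc k) ≡ nothing)
    through-strings-transfer both e₁ e₂ =
      trans (eFn-other i f k (≢-sym i≢k) k≢si)
            (through-transfer k (suc k) Ti Tsi (≢-sym i≢k) k≢si both) ,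
      trans (eFn-other i f (suc k) (≢-sym i≢sk) (≢-sym si≢sk))
            (through-transfer (suc k) k (through-swap Ti) (through-swap Tsi) (≢-sym i≢sk) (≢-sym si≢sk) both)
      where
      Ti  : ThroughAfterCap i k (suc k)
      Ti  = through-k i (trans (sym (eFn-other k f i i≢k i≢sk)) e₁)
      Tsi : ThroughAfterCap (suc i) k (suc k)
      Tsi = through-k (suc i) (trans (sym (eFn-other k f (suc i) (≢-sym k≢si) si≢sk)) e₂)

-- The invariant carried through the whole argument: a has length n and its
-- partner relation is symmetric and irreflexive.
record WellPaired (n : ℕ) (a : Diagram) : Set where
  field
    len    : length a ≡ n
    symm   : ∀ j k → pt a j ≡ just k → pt a k ≡ just j
    irrefl : ∀ j → pt a j ≢ just j
open WellPaired public

-- the last two updates performed by eBasis: make (i, i+1) a cup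
placeCup : Diagram → ℕ → Diagram
placeCup x i = setPt (setPt x i (just (suc i))) (suc i) (just i)

module _ {n : ℕ} {a : Diagram} (W : WellPaired n a) where
  open ≡

  partner-inRange : ∀ j k → pt a j ≡ just k → (1 ≤ k) × (k ≤ n)
  partner-inRange j k e with pt-just⇒inRange a k j (symm W j k e)
  ... | p , q = p , subst (k ≤_) (len W) q

  placeCup-eFn : ∀ x i → 1 ≤ i → suc i ≤ n → length x ≡ n →
                 (∀ y → y ≢ i → y ≢ suc i → pt x y ≡ follow i (pt a) (pt a y)) →
                 ∀ y → pt (placeCup x i) y ≡ eFn i (pt a) y
  placeCup-eFn x i i≥1 i<n lx hx y with y ≟ suc i
  ... | yes refl = trans (pt-setPt-same (setPt x i _) (suc i) _ (s≤s z≤n)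
                           (subst (suc i ≤_) (sym (trans (length-setPt x i _) lx)) i<n))
                         (sym (eFn-suc i (pt a)))
  ... | no y≢si with y ≟ i
  ... | yes refl = trans (pt-setPt-other (setPt x y _) (suc y) _ y y≢si)
                   (trans (pt-setPt-same x y _ i≥1 (subst (y ≤_) (sym lx) (≤-trans (n≤1+n y) i<n)))
                          (sym (eFn-i y (pt a))))
  ... | no y≢i = trans (pt-setPt-other (setPt x i _) (suc i) _ y y≢si)
                 (trans (pt-setPt-other x i _ y y≢i)
                 (trans (hx y y≢i y≢si) (sym (eFn-other i (pt a) y y≢i y≢si))))

  private
    unchanged : ∀ i y → pt a y ≢ just i → pt a y ≢ just (suc i) → pt a y ≡ follow i (pt a) (pt a y)
    unchanged i y n₁ n₂ = sym (follow-id i (pt a) (pt a y) n₁ n₂)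

    setPt-partner : ∀ j k v → pt a j ≡ just k → pt (setPt a k v) k ≡ v
    setPt-partner j k v e = pt-setPt-same a k v (proj₁ (partner-inRange _ _ e))
                              (subst (k ≤_) (sym (len W)) (proj₂ (partner-inRange _ _ e)))

  reroute-through-cup : ∀ i k → pt a i ≡ nothing → pt a (suc i) ≡ just k →
                        ∀ y → y ≢ i → y ≢ suc i → pt (setPt a k nothing) y ≡ follow i (pt a) (pt a y)
  reroute-through-cup i k ei ek y _ _ with y ≟ k
  ... | yes refl = trans (setPt-partner _ _ _ ek)
                         (sym (trans (cong (follow i (pt a)) (symm W _ _ ek)) (trans (follow-suc i (pt a)) ei)))
  ... | no y≢k = trans (pt-setPt-other a k nothing y y≢k)
                       (unchanged i y (λ e → just≢nothing (trans (sym (symm W _ _ e)) ei))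
                                      (λ e → y≢k (just-injective (trans (sym (symm W _ _ e)) ek))))

  reroute-cup-through : ∀ i j → pt a i ≡ just j → pt a (suc i) ≡ nothing →
                        ∀ y → y ≢ i → y ≢ suc i → pt (setPt a j nothing) y ≡ follow i (pt a) (pt a y)
  reroute-cup-through i j ej ei y _ _ with y ≟ j
  ... | yes refl = trans (setPt-partner _ _ _ ej)
                         (sym (trans (cong (follow i (pt a)) (symm W _ _ ej)) (trans (follow-i i (pt a)) ei)))
  ... | no y≢j = trans (pt-setPt-other a j nothing y y≢j)
                       (unchanged i y (λ e → y≢j (just-injective (trans (sym (symm W _ _ e)) ej)))
                                      (λ e → just≢nothing (trans (sym (symm W _ _ e)) ei)))

  reroute-cup-cup : ∀ i j k → pt a i ≡ just j → pt a (suc i) ≡ just k →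
                    ∀ y → y ≢ i → y ≢ suc i →
                    pt (setPt (setPt a j (just k)) k (just j)) y ≡ follow i (pt a) (pt a y)
  reroute-cup-cup i j k ej ek y _ _ with y ≟ k
  ... | yes refl = trans (pt-setPt-same (setPt a j _) y _ (proj₁ (partner-inRange _ _ ek))
                           (subst (y ≤_) (sym (trans (length-setPt a j _) (len W))) (proj₂ (partner-inRange _ _ ek))))
                         (sym (trans (cong (follow i (pt a)) (symm W _ _ ek)) (trans (follow-suc i (pt a)) ej)))
  ... | no y≢k with y ≟ j
  ... | yes refl = trans (pt-setPt-other (setPt a y _) k _ y y≢k)
                   (trans (setPt-partner _ _ _ ej)
                          (sym (trans (cong (follow i (pt a)) (symm W _ _ ej)) (trans (follow-i i (pt a)) ek))))
  ... | no y≢j = trans (pt-setPt-other (setPt a j _) k _ y y≢k)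
                 (trans (pt-setPt-other a j _ y y≢j)
                        (unchanged i y (λ e → y≢j (just-injective (trans (sym (symm W _ _ e)) ej)))
                                       (λ e → y≢k (just-injective (trans (sym (symm W _ _ e)) ek)))))

  eFn-wellPaired : ∀ i b → length b ≡ n → (∀ y → pt b y ≡ eFn i (pt a) y) → WellPaired n b
  eFn-wellPaired i b l h = record
    { len    = l
    ; symm   = λ j k e → trans (h k) (Pairing.eFn-symmetric (symm W) (irrefl W) i j k (trans (sym (h j)) e))
    ; irrefl = λ j e → Pairing.eFn-irreflexive (symm W) (irrefl W) i j (trans (sym (h j)) e)
    }

module Action {c ℓ : Level} (F : Field c ℓ) (q : Field.Carrier F) where
  open Field F using (Carrier; _*_)
  open TL F q
  open ≡

  data EiCase (n i : ℕ) (a : Diagram) : Set c where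
    closesLoop : pt a i ≡ just (suc i) → (∀ x → eBasis i x a ≡ (q * x , a) ∷ []) → EiCase n i a
    joinsThroughStrings : pt a i ≡ nothing → pt a (suc i) ≡ nothing → (∀ x → eBasis i x a ≡ []) → EiCase n i a
    reconnects : (b : Diagram) → pt a i ≢ just (suc i) → ¬ (pt a i ≡ nothing × pt a (suc i) ≡ nothing) →
                 WellPaired n b → (∀ y → pt b y ≡ eFn i (pt a) y) → (∀ x → eBasis i x a ≡ (x , b) ∷ []) →
                 EiCase n i a

  eBasis-loop : ∀ a i x → pt a i ≡ just (suc i) → pt a (suc i) ≡ just i → eBasis i x a ≡ (q * x , a) ∷ []
  eBasis-loop a i x e₁ e₂ rewrite e₁ | e₂ with suc i ≟ suc i
  ... | yes _ = refl
  ... | no ne = ⊥-elim (ne refl)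

  eBasis-through-through : ∀ a i x → pt a i ≡ nothing → pt a (suc i) ≡ nothing → eBasis i x a ≡ []
  eBasis-through-through a i x e₁ e₂ rewrite e₁ | e₂ = refl

  private
    eBasis-through-cup : ∀ a i k x → pt a i ≡ nothing → pt a (suc i) ≡ just k →
                         eBasis i x a ≡ (x , placeCup (setPt a k nothing) i) ∷ []
    eBasis-through-cup a i k x e₁ e₂ rewrite e₁ | e₂ = refl

    eBasis-cup-through : ∀ a i j x → pt a i ≡ just j → pt a (suc i) ≡ nothing →
                         eBasis i x a ≡ (x , placeCup (setPt a j nothing) i) ∷ []
    eBasis-cup-through a i j x e₁ e₂ rewrite e₁ | e₂ = refl

    eBasis-cup-cup : ∀ a i j k x → pt a i ≡ just j → pt a (suc i) ≡ just k → j ≢ suc i →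
                     eBasis i x a ≡ (x , placeCup (setPt (setPt a j (just k)) k (just j)) i) ∷ []
    eBasis-cup-cup a i j k x e₁ e₂ ne rewrite e₁ | e₂ with j ≟ suc i
    ... | yes e = ⊥-elim (ne e)
    ... | no _  = refl

    reconnected : ∀ {n a i} → WellPaired n a → 1 ≤ i → suc i ≤ n →
                  ∀ x → length x ≡ length a → (∀ y → y ≢ i → y ≢ suc i → pt x y ≡ follow i (pt a) (pt a y)) →
                  pt a i ≢ just (suc i) → ¬ (pt a i ≡ nothing × pt a (suc i) ≡ nothing) →
                  (∀ y → eBasis i y a ≡ (y , placeCup x i) ∷ []) → EiCase n i a
    reconnected {n} {a} {i} W i≥1 i<n x lx hx nc nt eq =
      reconnects (placeCup x i) nc nt (eFn-wellPaired W i _ lb pb) pb eq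
      where
      lx′ : length x ≡ n
      lx′ = trans lx (len W)
      lb : length (placeCup x i) ≡ n
      lb = trans (length-setPt (setPt x i _) (suc i) _) (trans (length-setPt x i _) lx′)
      pb : ∀ y → pt (placeCup x i) y ≡ eFn i (pt a) y
      pb = placeCup-eFn W x i i≥1 i<n lx′ hx

  eiCase : ∀ {n} a i → WellPaired n a → 1 ≤ i → suc i ≤ n → EiCase n i a
  eiCase {n} a i W i≥1 i<n with pt a i in e₁ | pt a (suc i) in e₂
  ... | nothing | nothing = joinsThroughStrings e₁ e₂ (λ x → eBasis-through-through a i x e₁ e₂)
  ... | nothing | just k =
    reconnected W i≥1 i<n (setPt a k nothing) (length-setPt a k _) (reroute-through-cup W i k e₁ e₂)
      (λ e → just≢nothing (trans (sym e) e₁)) (λ (_ , e) → just≢nothing (trans (sym e₂) e))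
      (λ x → eBasis-through-cup a i k x e₁ e₂)
  ... | just j | nothing =
    reconnected W i≥1 i<n (setPt a j nothing) (length-setPt a j _) (reroute-cup-through W i j e₁ e₂)
      (λ e → just≢nothing (trans (sym (symm W _ _ e)) e₂)) (λ (e , _) → just≢nothing (trans (sym e₁) e))
      (λ x → eBasis-cup-through a i j x e₁ e₂)
  ... | just j | just k with j ≟ suc i
  ...   | yes refl = closesLoop e₁ (λ x → eBasis-loop a i x e₁ (symm W _ _ e₁))
  ...   | no j≢si =
    reconnected W i≥1 i<n (setPt (setPt a j (just k)) k (just j))
      (trans (length-setPt (setPt a j _) k _) (length-setPt a j _)) (reroute-cup-cup W i j k e₁ e₂)
      (λ e → j≢si (just-injective (trans (sym e₁) e))) (λ (e , _) → just≢nothing (trans (sym e₁) e))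
      (λ x → eBasis-cup-cup a i j k x e₁ e₂ j≢si)

  private
    singleton-≡ : ∀ {y : Carrier} {b d : Diagram} → b ≡ d → (y , b) ∷ [] ≡ (y , d) ∷ []
    singleton-≡ refl = refl

  eAct-singleton : ∀ i x a → eAct i ((x , a) ∷ []) ≡ eBasis i x a
  eAct-singleton i x a = List.++-identityʳ _

  e-onCup : ∀ {n i d} → WellPaired n d → pt d i ≡ just (suc i) → ∀ y → eAct i ((y , d) ∷ []) ≡ (q * y , d) ∷ []
  e-onCup {i = i} {d} W e y = trans (eAct-singleton i y d) (eBasis-loop d i y e (symm W _ _ e))

  zigzag↑-onCup : ∀ {n i d} → WellPaired n d → 1 ≤ i → suc (suc i) ≤ n → pt d (suc i) ≡ just (suc (suc i)) →
                  ∀ y → eAct (suc i) (eAct i ((y , d) ∷ [])) ≡ (y , d) ∷ []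
  zigzag↑-onCup {n} {i} {d} W i≥1 i<n e y with eiCase d i W i≥1 (≤-trans (n≤1+n _) i<n)
  ... | closesLoop e₁ _ = ⊥-elim (n≢2+n (just-injective (trans (sym (symm W _ _ e₁)) e)))
  ... | joinsThroughStrings _ e₂ _ = ⊥-elim (just≢nothing (trans (sym e) e₂))
  ... | reconnects b _ _ Wb pb Eb with eiCase b (suc i) Wb (s≤s z≤n) i<n
  ...   | closesLoop e₁ _ = ⊥-elim (n≢2+n (just-injective (trans (sym (trans (pb _) (eFn-suc i (pt d)))) e₁)))
  ...   | joinsThroughStrings e₁ _ _ = ⊥-elim (just≢nothing (trans (sym (trans (pb _) (eFn-suc i (pt d)))) e₁))
  ...   | reconnects c _ _ Wc pc Ec =
    trans (cong (eAct (suc i)) (trans (eAct-singleton i y d) (Eb y)))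
      (trans (eAct-singleton (suc i) y b) (trans (Ec y) (singleton-≡ (diagram-ext c d (trans (len Wc) (sym (len W)))
        (λ z → trans (pc z) (trans (eFn-cong (suc i) pb z) (Pairing.eFn-zigzag↑ (symm W) (irrefl W) i e z)))))))

  zigzag↓-onCup : ∀ {n i d} → WellPaired n d → 1 ≤ i → suc (suc i) ≤ n → pt d i ≡ just (suc i) →
                  ∀ y → eAct i (eAct (suc i) ((y , d) ∷ [])) ≡ (y , d) ∷ []
  zigzag↓-onCup {n} {i} {d} W i≥1 i<n e y with eiCase d (suc i) W (s≤s z≤n) i<n
  ... | closesLoop e₁ _ = ⊥-elim (n≢2+n (just-injective (trans (sym (symm W _ _ e)) e₁)))
  ... | joinsThroughStrings e₁ _ _ = ⊥-elim (just≢nothing (trans (sym (symm W _ _ e)) e₁))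
  ... | reconnects b _ _ Wb pb Eb with eiCase b i Wb i≥1 (≤-trans (n≤1+n _) i<n)
  ...   | closesLoop e₁ _ = ⊥-elim (n≢2+n (just-injective (trans (sym (symm Wb _ _ e₁)) (trans (pb _) (eFn-i (suc i) (pt d))))))
  ...   | joinsThroughStrings _ e₁ _ = ⊥-elim (just≢nothing (trans (sym (trans (pb _) (eFn-i (suc i) (pt d)))) e₁))
  ...   | reconnects c _ _ Wc pc Ec =
    trans (cong (eAct i) (trans (eAct-singleton (suc i) y d) (Eb y)))
      (trans (eAct-singleton i y b) (trans (Ec y) (singleton-≡ (diagram-ext c d (trans (len Wc) (sym (len W)))
        (λ z → trans (pc z) (trans (eFn-cong i pb z) (Pairing.eFn-zigzag↓ (symm W) (irrefl W) i e z)))))))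

  -- Relations on the image e_i ξ_a of an arbitrary well-paired basis vector:
  -- every nonzero e_i ξ_a has a cup at (i, i+1), so the above apply.

  idempotent-basis : ∀ {n i a} → WellPaired n a → 1 ≤ i → suc i ≤ n → ∀ x →
                     eAct i (eBasis i x a) ≡ scale q (eBasis i x a)
  idempotent-basis {n} {i} {a} W i≥1 i<n x with eiCase a i W i≥1 i<n
  ... | closesLoop e E = trans (cong (eAct i) (E x)) (trans (e-onCup W e (q * x)) (sym (cong (scale q) (E x))))
  ... | joinsThroughStrings _ _ E = trans (cong (eAct i) (E x)) (sym (cong (scale q) (E x)))
  ... | reconnects b _ _ Wb pb E =
    trans (cong (eAct i) (E x)) (trans (e-onCup Wb (trans (pb _) (eFn-i i (pt a))) x) (sym (cong (scale q) (E x))))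

  zigzag↑-basis : ∀ {n i a} → WellPaired n a → 1 ≤ i → suc (suc i) ≤ n → ∀ x →
                  eAct (suc i) (eAct i (eBasis (suc i) x a)) ≡ eBasis (suc i) x a
  zigzag↑-basis {n} {i} {a} W i≥1 i<n x with eiCase a (suc i) W (s≤s z≤n) i<n
  ... | closesLoop e E =
    trans (cong (eAct (suc i) ∘ eAct i) (E x)) (trans (zigzag↑-onCup W i≥1 i<n e (q * x)) (sym (E x)))
  ... | joinsThroughStrings _ _ E = trans (cong (eAct (suc i) ∘ eAct i) (E x)) (sym (E x))
  ... | reconnects b _ _ Wb pb E =
    trans (cong (eAct (suc i) ∘ eAct i) (E x))
          (trans (zigzag↑-onCup Wb i≥1 i<n (trans (pb _) (eFn-i (suc i) (pt a))) x) (sym (E x)))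

  zigzag↓-basis : ∀ {n i a} → WellPaired n a → 1 ≤ i → suc (suc i) ≤ n → ∀ x →
                  eAct i (eAct (suc i) (eBasis i x a)) ≡ eBasis i x a
  zigzag↓-basis {n} {i} {a} W i≥1 i<n x with eiCase a i W i≥1 (≤-trans (n≤1+n _) i<n)
  ... | closesLoop e E =
    trans (cong (eAct i ∘ eAct (suc i)) (E x)) (trans (zigzag↓-onCup W i≥1 i<n e (q * x)) (sym (E x)))
  ... | joinsThroughStrings _ _ E = trans (cong (eAct i ∘ eAct (suc i)) (E x)) (sym (E x))
  ... | reconnects b _ _ Wb pb E =
    trans (cong (eAct i ∘ eAct (suc i)) (E x))
          (trans (zigzag↓-onCup Wb i≥1 i<n (trans (pb _) (eFn-i i (pt a))) x) (sym (E x)))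

  -- e_i e_k = e_k e_i on basis vectors, for |i - k| ≥ 2.  The cases where
  -- e_k closes a loop or kills ξ_a are handled for an arbitrary ordered pair
  -- (i, k); the remaining case is symmetric and reduces to eFn-commute.
  module CommuteOneSided {n : ℕ} {a : Diagram} (W : WellPaired n a) (i k : ℕ) (i≥1 : 1 ≤ i) (i<n : suc i ≤ n)
                         (i≢k : i ≢ k) (i≢sk : i ≢ suc k) (k≢si : k ≢ suc i) where
    open Pairing.Distant (symm W) (irrefl W) i k i≢k i≢sk k≢si

    k-loop : pt a k ≡ just (suc k) → (∀ x → eBasis k x a ≡ (q * x , a) ∷ []) →
             ∀ x → eAct i (eBasis k x a) ≡ eAct k (eBasis i x a)
    k-loop ek Ek x with eiCase a i W i≥1 i<n
    ... | closesLoop _ Ei =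
      trans (cong (eAct i) (Ek x)) (trans (eAct-singleton i _ a) (trans (Ei (q * x))
        (sym (trans (cong (eAct k) (Ei x)) (trans (eAct-singleton k _ a) (Ek (q * x)))))))
    ... | joinsThroughStrings _ _ Ei =
      trans (cong (eAct i) (Ek x)) (trans (eAct-singleton i _ a) (trans (Ei (q * x)) (sym (cong (eAct k) (Ei x)))))
    ... | reconnects b _ _ Wb pb Ei =
      trans (cong (eAct i) (Ek x)) (trans (eAct-singleton i _ a) (trans (Ei (q * x))
        (sym (trans (cong (eAct k) (Ei x)) (trans (eAct-singleton k _ b) (eBasis-loop b k x cup (symm Wb _ _ cup)))))))
      where
      cup : pt b k ≡ just (suc k)
      cup = trans (pb k) (cup-kept ek)

    k-kill : pt a k ≡ nothing → pt a (suc k) ≡ nothing → (∀ x → eBasis k x a ≡ []) →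
             ∀ x → eAct i (eBasis k x a) ≡ eAct k (eBasis i x a)
    k-kill ek esk Ek x with eiCase a i W i≥1 i<n
    ... | closesLoop _ Ei =
      trans (cong (eAct i) (Ek x)) (sym (trans (cong (eAct k) (Ei x)) (trans (eAct-singleton k _ a) (Ek (q * x)))))
    ... | joinsThroughStrings _ _ Ei = trans (cong (eAct i) (Ek x)) (sym (cong (eAct k) (Ei x)))
    ... | reconnects b _ _ Wb pb Ei =
      trans (cong (eAct i) (Ek x)) (sym (trans (cong (eAct k) (Ei x)) (trans (eAct-singleton k _ b)
        (eBasis-through-through b k x (trans (pb k) (eFn-through i k (≢-sym i≢k) k≢si ek))
                                       (trans (pb (suc k)) (eFn-through i (suc k) (≢-sym i≢sk) (≢-sym si≢sk) esk))))))

  module _ {n : ℕ} {a : Diagram} (W : WellPaired n a) (i k : ℕ) (i≥1 : 1 ≤ i) (i<n : suc i ≤ n)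
           (k≥1 : 1 ≤ k) (k<n : suc k ≤ n) (i≢k : i ≢ k) (i≢sk : i ≢ suc k) (k≢si : k ≢ suc i) where
    private
      module one-sided-ik = CommuteOneSided W i k i≥1 i<n i≢k i≢sk k≢si
      module one-sided-ki = CommuteOneSided W k i k≥1 k<n (≢-sym i≢k) k≢si i≢sk
      module distant-ik = Pairing.Distant (symm W) (irrefl W) i k i≢k i≢sk k≢si
      module distant-ki = Pairing.Distant (symm W) (irrefl W) k i (≢-sym i≢k) k≢si i≢sk

      both-reconnect : ∀ bk bi → WellPaired n bk → WellPaired n bi →
                       (∀ y → pt bk y ≡ eFn k (pt a) y) → (∀ y → pt bi y ≡ eFn i (pt a) y) →
                       pt a i ≢ just (suc i) → ¬ (pt a i ≡ nothing × pt a (suc i) ≡ nothing) →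
                       pt a k ≢ just (suc k) → ¬ (pt a k ≡ nothing × pt a (suc k) ≡ nothing) →
                       ∀ x → eBasis i x bk ≡ eBasis k x bi
      both-reconnect bk bi Wbk Wbi pbk pbi nci nti nck ntk x with eiCase bk i Wbk i≥1 i<n
      ... | closesLoop e Ec =
        trans (Ec x) (sym (trans (eBasis-loop bi k x cup (symm Wbi _ _ cup)) (singleton-≡ (sym bk≡bi))))
        where
        cup : pt bi k ≡ just (suc k)
        cup = trans (pbi k) (distant-ik.cup-transfer nci (trans (sym (pbk i)) e))
        bk≡bi : bk ≡ bi
        bk≡bi = diagram-ext bk bi (trans (len Wbk) (sym (len Wbi))) λ y →
          trans (sym (Pairing.eFn-cup (symm Wbk) (irrefl Wbk) i e y))
            (trans (eFn-cong i pbk y) (trans (distant-ik.eFn-commute y)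
              (trans (eFn-cong k (λ z → sym (pbi z)) y) (Pairing.eFn-cup (symm Wbi) (irrefl Wbi) k cup y))))
      ... | joinsThroughStrings e₁ e₂ E₀ =
        trans (E₀ x) (sym (eBasis-through-through bi k x (trans (pbi k) (proj₁ z)) (trans (pbi (suc k)) (proj₂ z))))
        where z = distant-ik.through-strings-transfer nti (trans (sym (pbk i)) e₁) (trans (sym (pbk (suc i))) e₂)
      ... | reconnects c nc₂ nt₂ Wc pc Ec with eiCase bi k Wbi k≥1 k<n
      ...   | closesLoop e _ = ⊥-elim (nc₂ (trans (pbk i) (distant-ki.cup-transfer nck (trans (sym (pbi k)) e))))
      ...   | joinsThroughStrings e₁ e₂ _ = ⊥-elim (nt₂ (trans (pbk i) (proj₁ z) , trans (pbk (suc i)) (proj₂ z)))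
        where z = distant-ki.through-strings-transfer ntk (trans (sym (pbi k)) e₁) (trans (sym (pbi (suc k))) e₂)
      ...   | reconnects d _ _ Wd pd Ed =
        trans (Ec x) (trans (singleton-≡ (diagram-ext c d (trans (len Wc) (sym (len Wd))) λ y →
          trans (pc y) (trans (eFn-cong i pbk y) (trans (distant-ik.eFn-commute y)
            (trans (eFn-cong k (λ z → sym (pbi z)) y) (sym (pd y)))))))
          (sym (Ed x)))

    commute-basis : ∀ x → eAct i (eBasis k x a) ≡ eAct k (eBasis i x a)
    commute-basis x with eiCase a k W k≥1 k<n
    ... | closesLoop ek Ek = one-sided-ik.k-loop ek Ek x
    ... | joinsThroughStrings ek esk Ek = one-sided-ik.k-kill ek esk Ek x
    ... | reconnects bk nck ntk Wbk pbk Ek with eiCase a i W i≥1 i<n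
    ...   | closesLoop ei Ei = sym (one-sided-ki.k-loop ei Ei x)
    ...   | joinsThroughStrings ei esi Ei = sym (one-sided-ki.k-kill ei esi Ei x)
    ...   | reconnects bi nci nti Wbi pbi Ei =
      trans (cong (eAct i) (Ek x)) (trans (eAct-singleton i _ bk)
        (trans (both-reconnect bk bi Wbk Wbi pbk pbi nci nti nck ntk x)
               (sym (trans (cong (eAct k) (Ei x)) (eAct-singleton k _ bi)))))

  AllWellPaired : ℕ → LC → Set c
  AllWellPaired n = All (WellPaired n ∘ proj₂)

  eAct-wellPaired : ∀ {n} i v → 1 ≤ i → suc i ≤ n → AllWellPaired n v → AllWellPaired n (eAct i v)
  eAct-wellPaired i [] _ _ All.[] = All.[]
  eAct-wellPaired i ((x , a) ∷ v) i≥1 i<n (W All.∷ Ws) =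
    All.++⁺ (basis (eiCase a i W i≥1 i<n)) (eAct-wellPaired i v i≥1 i<n Ws)
    where
    basis : EiCase _ i a → AllWellPaired _ (eBasis i x a)
    basis (closesLoop _ E)              rewrite E x = W All.∷ All.[]
    basis (joinsThroughStrings _ _ E)   rewrite E x = All.[]
    basis (reconnects b _ _ Wb _ E)     rewrite E x = Wb All.∷ All.[]

  eMinus-wellPaired : ∀ {n} i m v → 1 ≤ i → suc i ≤ n → AllWellPaired n v → AllWellPaired n (eMinus i m v)
  eMinus-wellPaired i m v i≥1 i<n Ws = All.++⁺ (eAct-wellPaired i v i≥1 i<n Ws) (All.map⁺ Ws)

  record TermWise (O : LC → LC) : Set c where
    constructor termWise
    field
      nil : O [] ≡ []
      ++-hom : ∀ u w → O (u ++ w) ≡ O u ++ O w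

  eAct-termWise : ∀ i → TermWise (eAct i)
  eAct-termWise i = termWise refl (List.concatMap-++ _)

  scale-termWise : ∀ x → TermWise (scale x)
  scale-termWise x = termWise refl (List.map-++ _)

  ∘-termWise : ∀ {O₁ O₂} → TermWise O₁ → TermWise O₂ → TermWise (O₁ ∘ O₂)
  ∘-termWise {O₁} (termWise z₁ h₁) (termWise z₂ h₂) =
    termWise (trans (cong O₁ z₂) z₁) (λ u w → trans (cong O₁ (h₂ u w)) (h₁ _ _))

  agree-from-basis : ∀ {n O₁ O₂} → TermWise O₁ → TermWise O₂ →
                     (∀ x a → WellPaired n a → O₁ ((x , a) ∷ []) ≡ O₂ ((x , a) ∷ [])) →
                     ∀ v → AllWellPaired n v → O₁ v ≡ O₂ v
  agree-from-basis T₁ T₂ h [] All.[] = trans (TermWise.nil T₁) (sym (TermWise.nil T₂))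
  agree-from-basis T₁ T₂ h ((x , a) ∷ v) (W All.∷ Ws) =
    trans (TermWise.++-hom T₁ ((x , a) ∷ []) v)
      (trans (cong₂ _++_ (h x a W) (agree-from-basis T₁ T₂ h v Ws)) (sym (TermWise.++-hom T₂ ((x , a) ∷ []) v)))

  module _ {n : ℕ} where
    idempotent : ∀ i → 1 ≤ i → suc i ≤ n → ∀ v → AllWellPaired n v → eAct i (eAct i v) ≡ scale q (eAct i v)
    idempotent i i≥1 i<n = agree-from-basis (∘-termWise (eAct-termWise i) (eAct-termWise i))
      (∘-termWise (scale-termWise q) (eAct-termWise i))
      λ x a W → trans (cong (eAct i) (eAct-singleton i x a))
                  (trans (idempotent-basis W i≥1 i<n x) (cong (scale q) (sym (eAct-singleton i x a))))

    zigzag↑ : ∀ i → 1 ≤ i → suc (suc i) ≤ n → ∀ v → AllWellPaired n v →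
              eAct (suc i) (eAct i (eAct (suc i) v)) ≡ eAct (suc i) v
    zigzag↑ i i≥1 i<n = agree-from-basis
      (∘-termWise (eAct-termWise (suc i)) (∘-termWise (eAct-termWise i) (eAct-termWise (suc i))))
      (eAct-termWise (suc i))
      λ x a W → trans (cong (eAct (suc i) ∘ eAct i) (eAct-singleton (suc i) x a))
                  (trans (zigzag↑-basis W i≥1 i<n x) (sym (eAct-singleton (suc i) x a)))

    zigzag↓ : ∀ i → 1 ≤ i → suc (suc i) ≤ n → ∀ v → AllWellPaired n v →
              eAct i (eAct (suc i) (eAct i v)) ≡ eAct i v
    zigzag↓ i i≥1 i<n = agree-from-basis
      (∘-termWise (eAct-termWise i) (∘-termWise (eAct-termWise (suc i)) (eAct-termWise i)))
      (eAct-termWise i)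
      λ x a W → trans (cong (eAct i ∘ eAct (suc i)) (eAct-singleton i x a))
                  (trans (zigzag↓-basis W i≥1 i<n x) (sym (eAct-singleton i x a)))

    commute : ∀ i k → 1 ≤ i → suc i ≤ n → 1 ≤ k → suc k ≤ n → i ≢ k → i ≢ suc k → k ≢ suc i →
              ∀ v → AllWellPaired n v → eAct i (eAct k v) ≡ eAct k (eAct i v)
    commute i k i≥1 i<n k≥1 k<n i≢k i≢sk k≢si = agree-from-basis
      (∘-termWise (eAct-termWise i) (eAct-termWise k)) (∘-termWise (eAct-termWise k) (eAct-termWise i))
      λ x a W → trans (cong (eAct i) (eAct-singleton k x a))
                  (trans (commute-basis W i k i≥1 i<n k≥1 k<n i≢k i≢sk k≢si x)
                         (cong (eAct k) (sym (eAct-singleton i x a))))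

module Linear {c ℓ : Level} (F : Field c ℓ) (q : Field.Carrier F) where
  open Field F
  open TL F q
  open import Relation.Binary.Reasoning.Setoid setoid
  open import Algebra.Properties.Ring ring using (-1*x≈-x)
  open import Algebra.Properties.Group +-group using (x∙y⁻¹≈ε⇒x≈y)

  infix 4 _≋_
  _≋_ : LC → LC → Set ℓ
  u ≋ w = ∀ b → coeff u b ≈ coeff w b

  ≡⇒≋ : ∀ {u w} → u ≡ w → u ≋ w
  ≡⇒≋ ≡.refl b = refl

  ≋-trans : ∀ {u v w} → u ≋ v → v ≋ w → u ≋ w
  ≋-trans h₁ h₂ b = trans (h₁ b) (h₂ b)

  coeff-++ : ∀ u w b → coeff (u ++ w) b ≈ coeff u b + coeff w b
  coeff-++ [] w b = sym (+-identityˡ _)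
  coeff-++ ((x , d) ∷ u) w b with d ≟D b
  ... | yes _ = trans (+-congˡ (coeff-++ u w b)) (sym (+-assoc _ _ _))
  ... | no _  = coeff-++ u w b

  coeff-scale : ∀ x u b → coeff (scale x u) b ≈ x * coeff u b
  coeff-scale x [] b = sym (zeroʳ x)
  coeff-scale x ((y , d) ∷ u) b with d ≟D b
  ... | yes _ = trans (+-congˡ (coeff-scale x u b)) (sym (distribˡ x y _))
  ... | no _  = coeff-scale x u b

  coeff-here : ∀ x a v → coeff ((x , a) ∷ v) a ≈ x + coeff v a
  coeff-here x a v with a ≟D a
  ... | yes _ = refl
  ... | no ne = ⊥-elim (ne ≡.refl)

  coeff-there : ∀ x a v b → a ≢ b → coeff ((x , a) ∷ v) b ≈ coeff v b
  coeff-there x a v b ne with a ≟D b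
  ... | yes e = ⊥-elim (ne e)
  ... | no _  = refl

  ++-cong : ∀ {u u′ w w′} → u ≋ u′ → w ≋ w′ → u ++ w ≋ u′ ++ w′
  ++-cong {u} {u′} {w} {w′} h₁ h₂ b = trans (coeff-++ u w b) (trans (+-cong (h₁ b) (h₂ b)) (sym (coeff-++ u′ w′ b)))

  scale-cong : ∀ x {u u′} → u ≋ u′ → scale x u ≋ scale x u′
  scale-cong x {u} {u′} h b = trans (coeff-scale x u b) (trans (*-congˡ (h b)) (sym (coeff-scale x u′ b)))

  -- A combination with all coefficients zero is invisible to every linear
  -- functional v ↦ Σ x_t K(a_t); hence such functionals respect ≋.
  evaluate : (Diagram → Carrier) → LC → Carrier
  evaluate K []            = 0#
  evaluate K ((x , a) ∷ v) = x * K a + evaluate K v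

  without : Diagram → LC → LC
  without a [] = []
  without a ((y , d) ∷ v) with d ≟D a
  ... | yes _ = without a v
  ... | no _  = (y , d) ∷ without a v

  module _ (K : Diagram → Carrier) where
    evaluate-++ : ∀ u w → evaluate K (u ++ w) ≈ evaluate K u + evaluate K w
    evaluate-++ [] w = sym (+-identityˡ _)
    evaluate-++ ((x , a) ∷ u) w = trans (+-congˡ (evaluate-++ u w)) (sym (+-assoc _ _ _))

    evaluate-scale : ∀ x u → evaluate K (scale x u) ≈ x * evaluate K u
    evaluate-scale x [] = sym (zeroʳ x)
    evaluate-scale x ((y , a) ∷ u) = trans (+-cong (*-assoc x y (K a)) (evaluate-scale x u)) (sym (distribˡ x _ _))

    evaluate-split : ∀ a v → evaluate K v ≈ coeff v a * K a + evaluate K (without a v)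
    evaluate-split a [] = sym (trans (+-identityʳ _) (zeroˡ _))
    evaluate-split a ((y , d) ∷ v) with d ≟D a
    ... | yes ≡.refl = begin
      y * K d + evaluate K v                                    ≈⟨ +-congˡ (evaluate-split d v) ⟩
      y * K d + (coeff v d * K d + evaluate K (without d v))    ≈⟨ sym (+-assoc _ _ _) ⟩
      (y * K d + coeff v d * K d) + evaluate K (without d v)    ≈⟨ +-congʳ (sym (distribʳ (K d) y _)) ⟩
      (y + coeff v d) * K d + evaluate K (without d v)          ∎
    ... | no _ = begin
      y * K d + evaluate K v                                    ≈⟨ +-congˡ (evaluate-split a v) ⟩
      y * K d + (coeff v a * K a + evaluate K (without a v))    ≈⟨ sym (+-assoc _ _ _) ⟩
      (y * K d + coeff v a * K a) + evaluate K (without a v)    ≈⟨ +-congʳ (+-comm _ _) ⟩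
      (coeff v a * K a + y * K d) + evaluate K (without a v)    ≈⟨ +-assoc _ _ _ ⟩
      coeff v a * K a + (y * K d + evaluate K (without a v))    ∎

    private
      without-length : ∀ a v → length (without a v) ≤ length v
      without-length a [] = z≤n
      without-length a ((y , d) ∷ v) with d ≟D a
      ... | yes _ = ≤-trans (without-length a v) (n≤1+n _)
      ... | no _  = s≤s (without-length a v)

      without-same : ∀ a v → coeff (without a v) a ≈ 0#
      without-same a [] = refl
      without-same a ((y , d) ∷ v) with d ≟D a
      ... | yes _ = without-same a v
      ... | no ne = trans (coeff-there y d (without a v) a ne) (without-same a v)

      without-other : ∀ a v b → b ≢ a → coeff (without a v) b ≈ coeff v b
      without-other a [] b ne = refl
      without-other a ((y , d) ∷ v) b ne with d ≟D a
      ... | yes ≡.refl = trans (without-other a v b ne) (sym (coeff-there y d v b (≢-sym ne)))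
        where open ≡ using (≢-sym)
      ... | no _ with d ≟D b
      ...   | yes _ = +-congˡ (without-other a v b ne)
      ...   | no _  = without-other a v b ne

      evaluate-null : ∀ bound v → length v ≤ bound → (∀ b → coeff v b ≈ 0#) → evaluate K v ≈ 0#
      evaluate-null _ [] _ _ = refl
      evaluate-null (suc bound) ((x , a) ∷ v) (s≤s l) null = begin
        x * K a + evaluate K v                               ≈⟨ +-congˡ (evaluate-split a v) ⟩
        x * K a + (coeff v a * K a + evaluate K (without a v)) ≈⟨ sym (+-assoc _ _ _) ⟩
        (x * K a + coeff v a * K a) + evaluate K (without a v) ≈⟨ +-congʳ (sym (distribʳ (K a) x _)) ⟩
        (x + coeff v a) * K a + evaluate K (without a v)      ≈⟨ +-congʳ (*-congʳ (trans (sym (coeff-here x a v)) (null a))) ⟩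
        0# * K a + evaluate K (without a v)                   ≈⟨ +-congʳ (zeroˡ _) ⟩
        0# + evaluate K (without a v)                         ≈⟨ +-identityˡ _ ⟩
        evaluate K (without a v)
          ≈⟨ evaluate-null bound (without a v) (≤-trans (without-length a v) l) null′ ⟩
        0#                                                    ∎
        where
        null′ : ∀ b → coeff (without a v) b ≈ 0#
        null′ b with b ≟D a
        ... | yes ≡.refl = without-same b v
        ... | no ne = trans (without-other a v b ne) (trans (sym (coeff-there x a v b (λ e → ne (≡.sym e)))) (null b))

    evaluate-cong : ∀ {v w} → v ≋ w → evaluate K v ≈ evaluate K w
    evaluate-cong {v} {w} h = x∙y⁻¹≈ε⇒x≈y (evaluate K v) (evaluate K w) (begin
      evaluate K v + - evaluate K w                  ≈⟨ +-congˡ (sym (-1*x≈-x (evaluate K w))) ⟩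
      evaluate K v + - 1# * evaluate K w             ≈⟨ +-congˡ (sym (evaluate-scale (- 1#) w)) ⟩
      evaluate K v + evaluate K (scale (- 1#) w)     ≈⟨ sym (evaluate-++ v (scale (- 1#) w)) ⟩
      evaluate K (v ++ scale (- 1#) w)               ≈⟨ evaluate-null _ (v ++ scale (- 1#) w) ≤-refl null ⟩
      0#                                             ∎)
      where
      null : ∀ b → coeff (v ++ scale (- 1#) w) b ≈ 0#
      null b = begin
        coeff (v ++ scale (- 1#) w) b           ≈⟨ coeff-++ v _ b ⟩
        coeff v b + coeff (scale (- 1#) w) b    ≈⟨ +-congˡ (coeff-scale (- 1#) w b) ⟩
        coeff v b + - 1# * coeff w b            ≈⟨ +-congˡ (-1*x≈-x _) ⟩
        coeff v b + - coeff w b                 ≈⟨ +-congʳ (h b) ⟩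
        coeff w b + - coeff w b                 ≈⟨ -‿inverseʳ _ ⟩
        0#                                      ∎

  private
    coeff-singleton : ∀ {u x w} d b → u ≈ x * w → coeff ((u , d) ∷ []) b ≈ x * coeff ((w , d) ∷ []) b
    coeff-singleton {u} {x} {w} d b e with d ≟D b
    ... | yes _ = trans (+-identityʳ u) (trans e (*-congˡ (sym (+-identityʳ w))))
    ... | no _  = sym (zeroʳ x)

    eBasis-linear : ∀ i x a b → coeff (eBasis i x a) b ≈ x * coeff (eBasis i 1# a) b
    eBasis-linear i x a b with pt a i | pt a (suc i)
    ... | nothing | nothing = sym (zeroʳ x)
    ... | nothing | just k  = coeff-singleton (placeCup (setPt a k nothing) i) b (sym (*-identityʳ x))
    ... | just j  | nothing = coeff-singleton (placeCup (setPt a j nothing) i) b (sym (*-identityʳ x))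
    ... | just j  | just k with j ℕ.≟ suc i
    ...   | yes _ = coeff-singleton a b (trans (*-comm q x) (*-congˡ (sym (*-identityʳ q))))
    ...   | no _  = coeff-singleton (placeCup (setPt (setPt a j (just k)) k (just j)) i) b (sym (*-identityʳ x))

  coeff-eAct : ∀ i v b → coeff (eAct i v) b ≈ evaluate (λ a → coeff (eBasis i 1# a) b) v
  coeff-eAct i [] b = refl
  coeff-eAct i ((x , a) ∷ v) b =
    trans (coeff-++ (eBasis i x a) (eAct i v) b) (+-cong (eBasis-linear i x a b) (coeff-eAct i v b))

  eAct-cong : ∀ i {v w} → v ≋ w → eAct i v ≋ eAct i w
  eAct-cong i {v} {w} h b = trans (coeff-eAct i v b) (trans (evaluate-cong _ {v} {w} h) (sym (coeff-eAct i w b)))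

  eAct-scale : ∀ i x v → eAct i (scale x v) ≋ scale x (eAct i v)
  eAct-scale i x v b = trans (coeff-eAct i (scale x v) b) (trans (evaluate-scale _ x v)
                         (trans (*-congˡ (sym (coeff-eAct i v b))) (sym (coeff-scale x (eAct i v) b))))

module Identities {c ℓ : Level} (F : Field c ℓ) (q : Field.Carrier F) where
  open Field F
  open TL F q
  open Action F q using (AllWellPaired; idempotent; zigzag↑; zigzag↓; commute)
  open Linear F q
  open import Relation.Binary.Reasoning.Setoid setoid
  open import Algebra.Properties.Ring ring using (-‿distribˡ-*; -‿distribʳ-*)
  open import Algebra.Properties.CommutativeSemigroup +-commutativeSemigroup using (interchange)
  open import Algebra.Properties.CommutativeSemigroup *-commutativeSemigroup using (x∙yz≈y∙xz)

  coeff-combination : ∀ u m w b → coeff (u ++ scale m w) b ≈ coeff u b + m * coeff w b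
  coeff-combination u m w b = trans (coeff-++ u _ b) (+-congˡ (coeff-scale m w b))

  eAct-combination : ∀ i u m w → eAct i (u ++ scale m w) ≋ eAct i u ++ scale m (eAct i w)
  eAct-combination i u m w b = begin
    coeff (eAct i (u ++ scale m w)) b                    ≡⟨ ≡.cong (λ t → coeff t b) (List.concatMap-++ _ u _) ⟩
    coeff (eAct i u ++ eAct i (scale m w)) b             ≈⟨ coeff-++ (eAct i u) _ b ⟩
    coeff (eAct i u) b + coeff (eAct i (scale m w)) b    ≈⟨ +-congˡ (eAct-scale i m w b) ⟩
    coeff (eAct i u) b + coeff (scale m (eAct i w)) b    ≈⟨ sym (coeff-++ (eAct i u) _ b) ⟩
    coeff (eAct i u ++ scale m (eAct i w)) b             ∎

  coeff-eAct-combination : ∀ i u m w b → coeff (eAct i (u ++ scale m w)) b ≈ coeff (eAct i u) b + m * coeff (eAct i w) b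
  coeff-eAct-combination i u m w b = trans (eAct-combination i u m w b) (coeff-combination (eAct i u) m (eAct i w) b)

  eMinus-cong : ∀ i m {v w} → v ≋ w → eMinus i m v ≋ eMinus i m w
  eMinus-cong i m {v} {w} h =
    ++-cong {eAct i v} {eAct i w} {scale (- m) v} {scale (- m) w} (eAct-cong i {v} {w} h) (scale-cong (- m) {v} {w} h)

  private
    exchange-scalars : ∀ X P Q W A B → (X + B * P) + A * (Q + B * W) ≈ (X + A * Q) + B * (P + A * W)
    exchange-scalars X P Q W A B = begin
      (X + B * P) + A * (Q + B * W)         ≈⟨ +-congˡ (distribˡ A Q _) ⟩
      (X + B * P) + (A * Q + A * (B * W))   ≈⟨ interchange X _ _ _ ⟩
      (X + A * Q) + (B * P + A * (B * W))   ≈⟨ +-congˡ (+-congˡ (x∙yz≈y∙xz A B W)) ⟩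
      (X + A * Q) + (B * P + B * (A * W))   ≈⟨ +-congˡ (sym (distribˡ B P _)) ⟩
      (X + A * Q) + B * (P + A * W)         ∎

    cancel : ∀ m m′ X → m * m′ ≈ 1# → X + (- m) * (m′ * X) ≈ 0#
    cancel m m′ X e = begin
      X + (- m) * (m′ * X)    ≈⟨ +-congˡ (sym (-‿distribˡ-* m _)) ⟩
      X + - (m * (m′ * X))    ≈⟨ +-congˡ (-‿cong (trans (sym (*-assoc _ _ _)) (trans (*-congʳ e) (*-identityˡ X)))) ⟩
      X + - X                 ≈⟨ -‿inverseʳ X ⟩
      0#                      ∎

  μ₁-inverse : ¬ (q ≈ 0#) → μ 1 * q ≈ 1#
  μ₁-inverse q≉0 = begin
    (1# * q ⁻¹) * q   ≈⟨ *-congʳ (*-identityˡ _) ⟩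
    q ⁻¹ * q          ≈⟨ *-comm _ _ ⟩
    q * q ⁻¹          ≈⟨ ⁻¹-inverse q q≉0 ⟩
    1#                ∎

  μ-recurrence : ∀ k → ¬ (Δ (suc k) ≈ 0#) → ¬ (Δ (suc (suc k)) ≈ 0#) → μ (suc (suc k)) * (q + - μ (suc k)) ≈ 1#
  μ-recurrence k Δ₁≉0 Δ₂≉0 = begin
    (B * C ⁻¹) * (q + - (A * B ⁻¹))        ≈⟨ *-congʳ (*-comm B _) ⟩
    (C ⁻¹ * B) * (q + - (A * B ⁻¹))        ≈⟨ *-assoc _ _ _ ⟩
    C ⁻¹ * (B * (q + - (A * B ⁻¹)))        ≈⟨ *-congˡ (distribˡ B q _) ⟩
    C ⁻¹ * (B * q + B * - (A * B ⁻¹))      ≈⟨ *-congˡ (+-cong (*-comm B q) (sym (-‿distribʳ-* B _))) ⟩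
    C ⁻¹ * (q * B + - (B * (A * B ⁻¹)))    ≈⟨ *-congˡ (+-congˡ (-‿cong (x∙yz≈y∙xz B A _))) ⟩
    C ⁻¹ * (q * B + - (A * (B * B ⁻¹)))
      ≈⟨ *-congˡ (+-congˡ (-‿cong (trans (*-congˡ (⁻¹-inverse B Δ₁≉0)) (*-identityʳ A)))) ⟩
    C ⁻¹ * (q * B + - A)                   ≈⟨ *-comm _ _ ⟩
    C * C ⁻¹                               ≈⟨ ⁻¹-inverse C Δ₂≉0 ⟩
    1#                                     ∎
    where
    A B C : Carrier
    A = Δ k
    B = Δ (suc k)
    C = Δ (suc (suc k))

  module _ {n : ℕ} where
    eMinus-commute : ∀ i k x y → 1 ≤ i → suc i ≤ n → 1 ≤ k → suc k ≤ n → i ≢ k → i ≢ suc k → k ≢ suc i →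
                     ∀ v → AllWellPaired n v → eMinus i x (eMinus k y v) ≋ eMinus k y (eMinus i x v)
    eMinus-commute i k x y i≥1 i<n k≥1 k<n i≢k i≢sk k≢si v Ws b = begin
      coeff (eMinus i x (eMinus k y v)) b
        ≈⟨ coeff-combination (eAct i (eMinus k y v)) (- x) (eMinus k y v) b ⟩
      coeff (eAct i (eMinus k y v)) b + (- x) * coeff (eMinus k y v) b
        ≈⟨ +-cong (coeff-eAct-combination i (eAct k v) (- y) v b) (*-congˡ (coeff-combination (eAct k v) (- y) v b)) ⟩
      (coeff (eAct i (eAct k v)) b + (- y) * coeff (eAct i v) b) + (- x) * (coeff (eAct k v) b + (- y) * coeff v b)
        ≈⟨ +-congʳ (+-congʳ (≡⇒≋ (commute i k i≥1 i<n k≥1 k<n i≢k i≢sk k≢si v Ws) b)) ⟩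
      (coeff (eAct k (eAct i v)) b + (- y) * coeff (eAct i v) b) + (- x) * (coeff (eAct k v) b + (- y) * coeff v b)
        ≈⟨ exchange-scalars _ _ _ _ _ _ ⟩
      (coeff (eAct k (eAct i v)) b + (- x) * coeff (eAct k v) b) + (- y) * (coeff (eAct i v) b + (- x) * coeff v b)
        ≈⟨ sym (+-cong (coeff-eAct-combination k (eAct i v) (- x) v b) (*-congˡ (coeff-combination (eAct i v) (- x) v b))) ⟩
      coeff (eAct k (eMinus i x v)) b + (- y) * coeff (eMinus i x v) b
        ≈⟨ sym (coeff-combination (eAct k (eMinus i x v)) (- y) (eMinus i x v) b) ⟩
      coeff (eMinus k y (eMinus i x v)) b ∎

    distant-kills : ∀ i k m v → 1 ≤ i → suc i ≤ n → 1 ≤ k → suc k ≤ n → i ≢ k → i ≢ suc k → k ≢ suc i →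
                    AllWellPaired n v → eAct i v ≋ [] → eAct i (eMinus k m v) ≋ []
    distant-kills i k m v i≥1 i<n k≥1 k<n i≢k i≢sk k≢si Ws z b = begin
      coeff (eAct i (eMinus k m v)) b
        ≈⟨ coeff-eAct-combination i (eAct k v) (- m) v b ⟩
      coeff (eAct i (eAct k v)) b + (- m) * coeff (eAct i v) b
        ≈⟨ +-cong (≡⇒≋ (commute i k i≥1 i<n k≥1 k<n i≢k i≢sk k≢si v Ws) b) (*-congˡ (z b)) ⟩
      coeff (eAct k (eAct i v)) b + (- m) * 0#
        ≈⟨ +-cong (eAct-cong k {eAct i v} {[]} z b) (zeroʳ _) ⟩
      0# + 0#
        ≈⟨ +-identityˡ _ ⟩
      0# ∎

    distant-eigen : ∀ i k m v → 1 ≤ i → suc i ≤ n → 1 ≤ k → suc k ≤ n → i ≢ k → i ≢ suc k → k ≢ suc i →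
                    AllWellPaired n v → eAct i v ≋ scale q v → eAct i (eMinus k m v) ≋ scale q (eMinus k m v)
    distant-eigen i k m v i≥1 i<n k≥1 k<n i≢k i≢sk k≢si Ws z b = begin
      coeff (eAct i (eMinus k m v)) b
        ≈⟨ coeff-eAct-combination i (eAct k v) (- m) v b ⟩
      coeff (eAct i (eAct k v)) b + (- m) * coeff (eAct i v) b
        ≈⟨ +-cong (≡⇒≋ (commute i k i≥1 i<n k≥1 k<n i≢k i≢sk k≢si v Ws) b) (*-congˡ (trans (z b) (coeff-scale q v b))) ⟩
      coeff (eAct k (eAct i v)) b + (- m) * (q * coeff v b)
        ≈⟨ +-cong (eAct-cong k {eAct i v} {scale q v} z b) (x∙yz≈y∙xz _ _ _) ⟩
      coeff (eAct k (scale q v)) b + q * ((- m) * coeff v b)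
        ≈⟨ +-congʳ (trans (eAct-scale k q v b) (coeff-scale q (eAct k v) b)) ⟩
      q * coeff (eAct k v) b + q * ((- m) * coeff v b)
        ≈⟨ sym (distribˡ q _ _) ⟩
      q * (coeff (eAct k v) b + (- m) * coeff v b)
        ≈⟨ *-congˡ (sym (coeff-combination (eAct k v) (- m) v b)) ⟩
      q * coeff (eMinus k m v) b
        ≈⟨ sym (coeff-scale q (eMinus k m v) b) ⟩
      coeff (scale q (eMinus k m v)) b ∎

  adjacent-peak₁ : ∀ S B v → ¬ (q ≈ 0#) → eAct S (eAct B (eAct S v)) ≡ eAct S v → eAct S v ≋ scale q v →
                   eAct S (eMinus B (μ 1) v) ≋ []
  adjacent-peak₁ S B v q≉0 zigzag eigen b = begin
    coeff (eAct S (eMinus B (μ 1) v)) b                                ≈⟨ coeff-eAct-combination S (eAct B v) (- μ 1) v b ⟩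
    coeff (eAct S (eAct B v)) b + (- μ 1) * coeff (eAct S v) b         ≈⟨ +-cong (e-e-v b) (*-congˡ (eigen′ b)) ⟩
    coeff v b + (- μ 1) * (q * coeff v b)                              ≈⟨ cancel (μ 1) q _ (μ₁-inverse q≉0) ⟩
    0#                                                                 ∎
    where
    eigen′ : ∀ b → coeff (eAct S v) b ≈ q * coeff v b
    eigen′ b = trans (eigen b) (coeff-scale q v b)
    -- v = q⁻¹ e_S v, hence e_S e_B v = q⁻¹ e_S e_B e_S v = q⁻¹ e_S v = v
    v≋ : v ≋ scale (q ⁻¹) (eAct S v)
    v≋ b = sym (begin
      coeff (scale (q ⁻¹) (eAct S v)) b   ≈⟨ coeff-scale _ (eAct S v) b ⟩
      q ⁻¹ * coeff (eAct S v) b           ≈⟨ *-congˡ (eigen′ b) ⟩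
      q ⁻¹ * (q * coeff v b)              ≈⟨ sym (*-assoc _ _ _) ⟩
      (q ⁻¹ * q) * coeff v b              ≈⟨ *-congʳ (trans (*-comm _ q) (⁻¹-inverse q q≉0)) ⟩
      1# * coeff v b                      ≈⟨ *-identityˡ _ ⟩
      coeff v b                           ∎)
    e-e-v : ∀ b → coeff (eAct S (eAct B v)) b ≈ coeff v b
    e-e-v b = begin
      coeff (eAct S (eAct B v)) b
        ≈⟨ eAct-cong S {eAct B v} {eAct B (scale (q ⁻¹) (eAct S v))} (eAct-cong B {v} {scale (q ⁻¹) (eAct S v)} v≋) b ⟩
      coeff (eAct S (eAct B (scale (q ⁻¹) (eAct S v)))) b
        ≈⟨ eAct-cong S {eAct B (scale (q ⁻¹) (eAct S v))} {scale (q ⁻¹) (eAct B (eAct S v))}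
                     (eAct-scale B (q ⁻¹) (eAct S v)) b ⟩
      coeff (eAct S (scale (q ⁻¹) (eAct B (eAct S v)))) b
        ≈⟨ eAct-scale S (q ⁻¹) (eAct B (eAct S v)) b ⟩
      coeff (scale (q ⁻¹) (eAct S (eAct B (eAct S v)))) b
        ≡⟨ ≡.cong (λ t → coeff (scale (q ⁻¹) t) b) zigzag ⟩
      coeff (scale (q ⁻¹) (eAct S v)) b
        ≈⟨ sym (v≋ b) ⟩
      coeff v b ∎

  adjacent-peak : ∀ S B μ₀ μ′ v₀ v₁ → eAct S (eAct B (eAct S v₁)) ≡ eAct S v₁ →
                  eAct S (eAct S v₁) ≡ scale q (eAct S v₁) → eAct B v₁ ≋ [] → v₀ ≋ eMinus S μ₀ v₁ →
                  μ′ * (q + - μ₀) ≈ 1# → eAct S (eMinus B μ′ v₀) ≋ []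
  adjacent-peak S B μ₀ μ′ v₀ v₁ zigzag idem killed v₀≋ inverse b = begin
    coeff (eAct S (eMinus B μ′ v₀)) b                              ≈⟨ coeff-eAct-combination S (eAct B v₀) (- μ′) v₀ b ⟩
    coeff (eAct S (eAct B v₀)) b + (- μ′) * coeff (eAct S v₀) b    ≈⟨ +-cong e-e-v₀ (*-congˡ e-v₀) ⟩
    A + (- μ′) * ((q + - μ₀) * A)                                  ≈⟨ cancel μ′ _ A inverse ⟩
    0#                                                             ∎
    where
    A : Carrier
    A = coeff (eAct S v₁) b
    -- e_S e_B v₀ = e_S e_B e_S v₁ - μ₀ e_S e_B v₁ = e_S v₁
    e-e-v₀ : coeff (eAct S (eAct B v₀)) b ≈ A
    e-e-v₀ = begin
      coeff (eAct S (eAct B v₀)) b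
        ≈⟨ eAct-cong S {eAct B v₀} {eAct B (eAct S v₁) ++ scale (- μ₀) (eAct B v₁)}
             (≋-trans {eAct B v₀} {eAct B (eMinus S μ₀ v₁)} {eAct B (eAct S v₁) ++ scale (- μ₀) (eAct B v₁)}
                      (eAct-cong B {v₀} {eMinus S μ₀ v₁} v₀≋)
                      (eAct-combination B (eAct S v₁) (- μ₀) v₁)) b ⟩
      coeff (eAct S (eAct B (eAct S v₁) ++ scale (- μ₀) (eAct B v₁))) b
        ≈⟨ coeff-eAct-combination S (eAct B (eAct S v₁)) (- μ₀) (eAct B v₁) b ⟩
      coeff (eAct S (eAct B (eAct S v₁))) b + (- μ₀) * coeff (eAct S (eAct B v₁)) b
        ≈⟨ +-cong (≡⇒≋ zigzag b) (*-congˡ (eAct-cong S {eAct B v₁} {[]} killed b)) ⟩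
      A + (- μ₀) * 0#
        ≈⟨ trans (+-congˡ (zeroʳ _)) (+-identityʳ A) ⟩
      A ∎
    -- e_S v₀ = e_S e_S v₁ - μ₀ e_S v₁ = (q - μ₀) e_S v₁
    e-v₀ : coeff (eAct S v₀) b ≈ (q + - μ₀) * A
    e-v₀ = begin
      coeff (eAct S v₀) b                            ≈⟨ eAct-cong S {v₀} {eMinus S μ₀ v₁} v₀≋ b ⟩
      coeff (eAct S (eMinus S μ₀ v₁)) b              ≈⟨ coeff-eAct-combination S (eAct S v₁) (- μ₀) v₁ b ⟩
      coeff (eAct S (eAct S v₁)) b + (- μ₀) * A      ≈⟨ +-congʳ (trans (≡⇒≋ idem b) (coeff-scale q (eAct S v₁) b)) ⟩
      q * A + (- μ₀) * A                             ≈⟨ sym (distribʳ A q _) ⟩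
      (q + - μ₀) * A                                 ∎

minimalHeight : ℕ → ℕ → ℕ
minimalHeight zero          m             = m
minimalHeight (suc p)       zero          = 0
minimalHeight (suc p)       (suc zero)    = 1
minimalHeight (suc p)       (suc (suc m)) = minimalHeight p m

-- a slope at position j+1 of a natural-valued height function
SlopeN : (ℕ → ℕ) → ℕ → Set
SlopeN h j = ((h (suc j) ≡ suc (h j)) × (h (suc (suc j)) ≡ suc (h (suc j))))
           ⊎ ((h j ≡ suc (h (suc j))) × (h (suc j) ≡ suc (h (suc (suc j)))))

module _ where
  open ≡
  open import Data.Nat using (_+_; _*_)
  open import Data.Nat.Properties using (+-suc; +-comm; 0≢1+n)
  open import Data.Integer as ℤ using () renaming (_+_ to _+ℤ_)
  open import Data.List using (replicate)
  import Data.Maybe as Maybe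
  open import Data.Bool using (if_then_else_)

  private
    two-pairs-fit : ∀ p n → 2 * suc p ≤ suc (suc n) → 2 * p ≤ n
    two-pairs-fit p n l rewrite +-suc p (p + 0) with l
    ... | s≤s (s≤s l′) = l′

    no-pair-fits-1 : ∀ p → ¬ (p + 1 * suc p ≤ 0)
    no-pair-fits-1 zero    ()
    no-pair-fits-1 (suc p) ()

    shift2 : Maybe ℕ → Maybe ℕ
    shift2 = Maybe.map (2 +_)

    pt-shift : ∀ l j → pt (map shift2 l) (suc j) ≡ shift2 (pt l (suc j))
    pt-shift []      j       = refl
    pt-shift (x ∷ l) zero    = refl
    pt-shift (x ∷ l) (suc j) = pt-shift l j

    pt-replicate : ∀ n j → pt (replicate n nothing) j ≡ nothing
    pt-replicate zero    j             = refl
    pt-replicate (suc n) zero          = refl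
    pt-replicate (suc n) (suc zero)    = refl
    pt-replicate (suc n) (suc (suc j)) = pt-replicate n (suc j)

    shift2-just : ∀ m k → shift2 m ≡ just k → Σ ℕ λ k′ → (k ≡ suc (suc k′)) × (m ≡ just k′)
    shift2-just (just x) .(suc (suc x)) refl = x , refl , refl

    minimalHeight-zero : ∀ p → minimalHeight p 0 ≡ 0
    minimalHeight-zero zero    = refl
    minimalHeight-zero (suc p) = refl

    bottom : ∀ p {x} → minimalHeight p 0 ≡ x → 0 ≡ x
    bottom p e = trans (sym (minimalHeight-zero p)) e

    n≢2+n′ : ∀ {j} → suc (suc j) ≢ j
    n≢2+n′ e = n≢2+n (sym e)

  minimalHeight-≤ : ∀ p m → minimalHeight p m ≤ m
  minimalHeight-≤ zero          m             = ≤-refl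
  minimalHeight-≤ (suc p)       zero          = z≤n
  minimalHeight-≤ (suc p)       (suc zero)    = s≤s z≤n
  minimalHeight-≤ (suc p)       (suc (suc m)) = ≤-trans (minimalHeight-≤ p m) (≤-trans (n≤1+n m) (n≤1+n _))

  minimal-peak-height : ∀ p j x → minimalHeight p (suc j) ≡ suc x → minimalHeight p j ≡ x →
                        minimalHeight p (suc (suc j)) ≡ x → x ≡ 0
  minimal-peak-height zero          j             x e₁ e₂ e₃ = ⊥-elim (n≢2+n′ (trans e₃ (sym e₂)))
  minimal-peak-height (suc p)       zero          x e₁ e₂ e₃ = sym e₂
  minimal-peak-height (suc p)       (suc zero)    x e₁ e₂ e₃ = ⊥-elim (0≢1+n (bottom p e₁))
  minimal-peak-height (suc p)       (suc (suc j)) x e₁ e₂ e₃ = minimal-peak-height p j x e₁ e₂ e₃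

  minimal-peak-cup : ∀ p n j → 2 * p ≤ n → minimalHeight p (suc j) ≡ 1 → minimalHeight p j ≡ 0 →
                     minimalHeight p (suc (suc j)) ≡ 0 → pt (minimal p n) (suc j) ≡ just (suc (suc j))
  minimal-peak-cup zero          n             j             _       e₁ e₂ e₃ = ⊥-elim (n≢2+n′ (trans e₃ (sym e₂)))
  minimal-peak-cup (suc p)       zero          j             ()      e₁ e₂ e₃
  minimal-peak-cup (suc p)       (suc zero)    j             (s≤s l) e₁ e₂ e₃ = ⊥-elim (no-pair-fits-1 p l)
  minimal-peak-cup (suc p)       (suc (suc n)) zero          _       e₁ e₂ e₃ = refl
  minimal-peak-cup (suc p)       (suc (suc n)) (suc zero)    _       e₁ e₂ e₃ =
    ⊥-elim (0≢1+n (bottom p e₁))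
  minimal-peak-cup (suc p)       (suc (suc n)) (suc (suc j)) l       e₁ e₂ e₃ =
    trans (pt-shift (minimal p n) j) (cong shift2 (minimal-peak-cup p n j (two-pairs-fit p n l) e₁ e₂ e₃))

  minimal-slope-through : ∀ p n j → 2 * p ≤ n → SlopeN (minimalHeight p) j →
                          (pt (minimal p n) (suc j) ≡ nothing) × (pt (minimal p n) (suc (suc j)) ≡ nothing)
  minimal-slope-through zero          n             j             _       _ = pt-replicate n (suc j) , pt-replicate n (suc (suc j))
  minimal-slope-through (suc p)       zero          j             ()      _
  minimal-slope-through (suc p)       (suc zero)    j             (s≤s l) _ = ⊥-elim (no-pair-fits-1 p l)
  minimal-slope-through (suc p)       (suc (suc n)) zero          _ (inj₁ (_ , e)) = ⊥-elim (0≢1+n (bottom p e))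
  minimal-slope-through (suc p)       (suc (suc n)) zero          _ (inj₂ (e , _)) = ⊥-elim (0≢1+n e)
  minimal-slope-through (suc p)       (suc (suc n)) (suc zero)    _ (inj₁ (e , _)) = ⊥-elim (0≢1+n (bottom p e))
  minimal-slope-through (suc p)       (suc (suc n)) (suc zero)    _ (inj₂ (_ , e)) = ⊥-elim (0≢1+n (bottom p e))
  minimal-slope-through (suc p)       (suc (suc n)) (suc (suc j)) l s
    with minimal-slope-through p n j (two-pairs-fit p n l) s
  ... | e₁ , e₂ = trans (pt-shift (minimal p n) j) (cong shift2 e₁) , trans (pt-shift (minimal p n) (suc j)) (cong shift2 e₂)

  minimal-wellPaired : ∀ p n → 2 * p ≤ n → WellPaired n (minimal p n)
  minimal-wellPaired p n l = record { len = length-minimal p n l ; symm = symmetric p n l ; irrefl = irreflexive p n l }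
    where
    length-minimal : ∀ p n → 2 * p ≤ n → length (minimal p n) ≡ n
    length-minimal zero          n             _       = List.length-replicate n
    length-minimal (suc p)       zero          ()
    length-minimal (suc p)       (suc zero)    (s≤s l) = ⊥-elim (no-pair-fits-1 p l)
    length-minimal (suc p)       (suc (suc n)) l       =
      cong (λ x → suc (suc x)) (trans (List.length-map _ (minimal p n)) (length-minimal p n (two-pairs-fit p n l)))

    symmetric : ∀ p n → 2 * p ≤ n → ∀ j k → pt (minimal p n) j ≡ just k → pt (minimal p n) k ≡ just j
    symmetric zero          n             _       j k e = ⊥-elim (just≢nothing (trans (sym e) (pt-replicate n j)))
    symmetric (suc p)       zero          ()
    symmetric (suc p)       (suc zero)    (s≤s l) j k e = ⊥-elim (no-pair-fits-1 p l)
    symmetric (suc p)       (suc (suc n)) l zero                k ()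
    symmetric (suc p)       (suc (suc n)) l (suc zero)          .2 refl = refl
    symmetric (suc p)       (suc (suc n)) l (suc (suc zero))    .1 refl = refl
    symmetric (suc p)       (suc (suc n)) l (suc (suc (suc j))) k  e
      with shift2-just (pt (minimal p n) (suc j)) k (trans (sym (pt-shift (minimal p n) j)) e)
    ... | k′ , refl , e′ with symmetric p n (two-pairs-fit p n l) (suc j) k′ e′
    ... | e″ with pt-just⇒inRange (minimal p n) k′ (suc j) e″
    ...   | s≤s z≤n , _ = trans (pt-shift (minimal p n) _) (cong shift2 e″)

    irreflexive : ∀ p n → 2 * p ≤ n → ∀ j → pt (minimal p n) j ≢ just j
    irreflexive zero          n             _       j e = just≢nothing (trans (sym e) (pt-replicate n j))
    irreflexive (suc p)       zero          ()
    irreflexive (suc p)       (suc zero)    (s≤s l) j e = no-pair-fits-1 p l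
    irreflexive (suc p)       (suc (suc n)) l zero ()
    irreflexive (suc p)       (suc (suc n)) l (suc zero) ()
    irreflexive (suc p)       (suc (suc n)) l (suc (suc zero)) ()
    irreflexive (suc p)       (suc (suc n)) l (suc (suc (suc j))) e
      with shift2-just (pt (minimal p n) (suc j)) _ (trans (sym (pt-shift (minimal p n) j)) e)
    ... | k′ , refl , e′ = irreflexive p n (two-pairs-fit p n l) (suc j) e′

  private
    step-through : ∀ a j → pt a j ≡ nothing → step a j ≡ ℤ.+ 1
    step-through a j e rewrite e = refl

    step-paired : ∀ a j k → pt a j ≡ just k → step a j ≡ (if j ℕ.<ᵇ k then ℤ.+ 1 else ℤ.- (ℤ.+ 1))
    step-paired a j k e rewrite e = refl

    height-replicate : ∀ n m → height (replicate n nothing) m ≡ ℤ.+ m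
    height-replicate n zero    = refl
    height-replicate n (suc m) =
      trans (cong₂ _+ℤ_ (height-replicate n m) (step-through (replicate n nothing) (suc m) (pt-replicate n (suc m))))
            (cong ℤ.+_ (+-comm m 1))

    height-shift : ∀ p n m → height (minimal (suc p) (suc (suc n))) (suc (suc m)) ≡ height (minimal p n) m
    height-shift p n zero    = refl
    height-shift p n (suc m) = cong₂ _+ℤ_ (height-shift p n m) (same-step (pt (minimal p n) (suc m)) refl)
      where
      a : Diagram
      a = minimal (suc p) (suc (suc n))
      same-step : ∀ w → pt (minimal p n) (suc m) ≡ w → step a (suc (suc (suc m))) ≡ step (minimal p n) (suc m)
      same-step nothing  e = trans (step-through a (suc (suc (suc m))) (trans (pt-shift (minimal p n) m) (cong shift2 e)))
                                   (sym (step-through (minimal p n) (suc m) e))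
      same-step (just t) e = trans (step-paired a (suc (suc (suc m))) (suc (suc t)) (trans (pt-shift (minimal p n) m) (cong shift2 e)))
                                   (sym (step-paired (minimal p n) (suc m) t e))

  height-minimal : ∀ p n → 2 * p ≤ n → ∀ m → height (minimal p n) m ≡ ℤ.+ (minimalHeight p m)
  height-minimal zero          n             _       m             = height-replicate n m
  height-minimal (suc p)       zero          ()
  height-minimal (suc p)       (suc zero)    (s≤s l) m             = ⊥-elim (no-pair-fits-1 p l)
  height-minimal (suc p)       (suc (suc n)) l       zero          = refl
  height-minimal (suc p)       (suc (suc n)) l       (suc zero)    = refl
  height-minimal (suc p)       (suc (suc n)) l       (suc (suc m)) =
    trans (height-shift p n m) (height-minimal p n (two-pairs-fit p n l) m)

record PeakN (h : ℕ → ℕ) (j x : ℕ) : Set where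
  constructor peak
  field
    left  : h j ≡ x
    top   : h (suc j) ≡ suc x
    right : h (suc (suc j)) ≡ x

record BoxN (h : ℕ → ℕ) (k : ℕ) (h′ : ℕ → ℕ) : Set where
  field
    left   : h k ≡ suc (h (suc k))
    right  : h (suc (suc k)) ≡ suc (h (suc k))
    raised : h′ (suc k) ≡ suc (suc (h (suc k)))
    others : ∀ m → m ≢ suc k → h′ m ≡ h m

data Position : ℕ → ℕ → Set where
  at      : ∀ {j} → Position j j
  toRight : ∀ {j} → Position (suc j) j
  toLeft  : ∀ {k} → Position k (suc k)
  apart   : ∀ {k j} → suc k ≢ suc j → suc k ≢ suc (suc j) → suc j ≢ suc (suc k) → Position k j

-- h with the value at i replaced by m; only its two defining equations are used
abstract
  update : (ℕ → ℕ) → ℕ → ℕ → ℕ → ℕ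
  update h i m x with x ≟ i
  ... | yes _ = m
  ... | no _  = h x

  update-same : ∀ h i m → update h i m i ≡ m
  update-same h i m with i ≟ i
  ... | yes _ = ≡.refl
  ... | no ne = ⊥-elim (ne ≡.refl)

  update-other : ∀ h i m x → x ≢ i → update h i m x ≡ h x
  update-other h i m x ne with x ≟ i
  ... | yes e = ⊥-elim (ne e)
  ... | no _  = ≡.refl

module _ where
  open ≡

  position : ∀ k j → Position k j
  position k j with k ≟ j
  ... | yes refl = at
  ... | no k≢j with k ≟ suc j
  ... | yes refl = toRight
  ... | no k≢sj with suc k ≟ j
  ... | yes refl = toLeft
  ... | no sk≢j = apart (λ e → k≢j (suc-injective e)) (λ e → k≢sj (suc-injective e)) (λ e → sk≢j (sym (suc-injective e)))

  private
    n≢1+n : ∀ {n} → n ≢ suc n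
    n≢1+n e = 1+n≢n (sym e)

  peak-of-box : ∀ {h k h′} → BoxN h k h′ → PeakN h′ k (suc (h (suc k)))
  peak-of-box {k = k} B = peak (trans (others k n≢1+n) left) raised (trans (others (suc (suc k)) 1+n≢n) right)
    where open BoxN B

  peak-unique : ∀ {h j x y} → PeakN h j x → PeakN h j y → x ≡ y
  peak-unique P Q = trans (sym (PeakN.left P)) (PeakN.left Q)

  adjacent-peaks : ∀ {h j x y} → PeakN h j x → PeakN h (suc j) y → ⊥
  adjacent-peaks P Q = n≢2+n (trans (sym (PeakN.right P)) (trans (PeakN.top Q)
                         (cong suc (trans (sym (PeakN.left Q)) (PeakN.top P)))))

  peak-not-slope : ∀ {h j x} → PeakN h j x → SlopeN h j → ⊥
  peak-not-slope P (inj₁ (_ , up))   = n≢2+n (trans (sym (PeakN.right P)) (trans up (cong suc (PeakN.top P))))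
  peak-not-slope P (inj₂ (down , _)) = n≢2+n (trans (sym (PeakN.left P)) (trans down (cong suc (PeakN.top P))))

  peak-transfer : ∀ {h g j x} → h j ≡ g j → h (suc j) ≡ g (suc j) → h (suc (suc j)) ≡ g (suc (suc j)) →
                  PeakN h j x → PeakN g j x
  peak-transfer e₀ e₁ e₂ (peak l t r) = peak (trans (sym e₀) l) (trans (sym e₁) t) (trans (sym e₂) r)

  slope-transfer : ∀ {h g j} → h j ≡ g j → h (suc j) ≡ g (suc j) → h (suc (suc j)) ≡ g (suc (suc j)) →
                   SlopeN h j → SlopeN g j
  slope-transfer e₀ e₁ e₂ (inj₁ (a , b)) =
    inj₁ (trans (sym e₁) (trans a (cong suc e₀)) , trans (sym e₂) (trans b (cong suc e₁)))
  slope-transfer e₀ e₁ e₂ (inj₂ (a , b)) =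
    inj₂ (trans (sym e₀) (trans a (cong suc e₁)) , trans (sym e₁) (trans b (cong suc e₂)))

  slope-right-of-box : ∀ {h j h′} → BoxN h (suc j) h′ → SlopeN h′ j → PeakN h j (h (suc (suc j)))
  slope-right-of-box {h} {j} {h′} B s = peak (left-value s) left refl
    where
    open BoxN B
    at-top : h′ (suc j) ≡ suc (h (suc (suc j)))
    at-top = trans (others (suc j) n≢1+n) left
    left-value : SlopeN h′ j → h j ≡ h (suc (suc j))
    left-value (inj₁ (up , _)) = trans (sym (others j n≢2+n)) (suc-injective (trans (sym up) at-top))
    left-value (inj₂ (_ , down)) = ⊥-elim (n≢2+n (suc-injective (trans (sym at-top) (trans down (cong suc raised)))))

  slope-left-of-box : ∀ {h k h′} → BoxN h k h′ → SlopeN h′ (suc k) → PeakN h (suc k) (h (suc k))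
  slope-left-of-box {h} {k} {h′} B s = peak refl right (right-value s)
    where
    open BoxN B
    at-top : h′ (suc (suc k)) ≡ suc (h (suc k))
    at-top = trans (others (suc (suc k)) 1+n≢n) right
    right-value : SlopeN h′ (suc k) → h (suc (suc (suc k))) ≡ h (suc k)
    right-value (inj₁ (up , _)) = ⊥-elim (n≢2+n (suc-injective (trans (sym at-top) (trans up (cong suc raised)))))
    right-value (inj₂ (_ , down)) = trans (sym (others (suc (suc (suc k))) (λ e → n≢2+n (sym e))))
                                          (suc-injective (trans (sym down) at-top))

  peak-apart : ∀ {h h′ k j x} → BoxN h k h′ → suc k ≢ suc j → suc k ≢ suc (suc j) → suc j ≢ suc (suc k) →
               PeakN h′ j x → PeakN h j x
  peak-apart {h} {h′} {k} {j} B K≢J K≢sJ J≢sK =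
    peak-transfer {h′} {h} {j} (others _ (λ e → J≢sK (cong suc e))) (others _ (≢-sym K≢J)) (others _ (λ e → K≢sJ (sym e)))
    where open BoxN B

  slope-apart : ∀ {h h′ k j} → BoxN h k h′ → suc k ≢ suc j → suc k ≢ suc (suc j) → suc j ≢ suc (suc k) →
                SlopeN h′ j → SlopeN h j
  slope-apart {h} {h′} {k} {j} B K≢J K≢sJ J≢sK =
    slope-transfer {h′} {h} {j} (others _ (λ e → J≢sK (cong suc e))) (others _ (≢-sym K≢J)) (others _ (λ e → K≢sJ (sym e)))
    where open BoxN B

  lowered-slope-right : ∀ {h₁ h₀ h j} → BoxN h₀ (suc j) h → BoxN h₁ j h₀ → SlopeN h₁ (suc j)
  lowered-slope-right {h₁} {h₀} {h} {j} B B₁ = inj₁ (at-min , trans (sym (B₁.others _ (λ e → n≢2+n (sym e))))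
                                                      (trans B.right (cong suc (sym at-min′))))
    where
    module B  = BoxN B
    module B₁ = BoxN B₁
    at-min′ : h₁ (suc (suc j)) ≡ h₀ (suc (suc j))
    at-min′ = sym (B₁.others _ 1+n≢n)
    at-min : h₁ (suc (suc j)) ≡ suc (h₁ (suc j))
    at-min = trans at-min′ (suc-injective (trans (sym B.left) B₁.raised))

  lowered-slope-left : ∀ {h₁ h₀ h k} → BoxN h₀ k h → BoxN h₁ (suc k) h₀ → SlopeN h₁ k
  lowered-slope-left {h₁} {h₀} {h} {k} B B₁ = inj₂ (trans (sym (B₁.others _ n≢2+n)) (trans B.left (cong suc at-min′)) ,
                                                  trans (sym at-min′) (suc-injective (trans (sym B.right) B₁.raised)))
    where
    module B  = BoxN B
    module B₁ = BoxN B₁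
    at-min′ : h₀ (suc k) ≡ h₁ (suc k)
    at-min′ = B₁.others _ n≢1+n

  boxes-commute : ∀ {h₁ h₀ h j k} → BoxN h₁ j h₀ → BoxN h₀ k h →
                  suc k ≢ suc j → suc k ≢ suc (suc j) → suc j ≢ suc (suc k) →
                  let h₁′ = update h (suc j) (h₁ (suc j)) in BoxN h₁ k h₁′ × BoxN h₁′ j h
  boxes-commute {h₁} {h₀} {h} {j} {k} B₁ B K≢J K≢sJ J≢sK = record
    { left   = trans (sym (B₁.others k (λ e → K≢sJ (cong suc e)))) (trans B.left (cong suc K₁))
    ; right  = trans (sym (B₁.others (suc (suc k)) (λ e → J≢sK (sym e)))) (trans B.right (cong suc K₁))
    ; raised = trans (update-other h _ _ (suc k) K≢J) (trans B.raised (cong (suc ∘ suc) K₁))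
    ; others = lowered-agrees
    } , record
    { left   = trans (update-other h _ _ j n≢1+n) (trans (B.others j (λ e → J≢sK (cong suc e)))
                 (trans (B₁.others j n≢1+n) (trans B₁.left (cong suc (sym (update-same h _ _))))))
    ; right  = trans (update-other h _ _ (suc (suc j)) 1+n≢n)
                 (trans (B.others (suc (suc j)) (λ e → K≢sJ (sym e)))
                 (trans (B₁.others (suc (suc j)) 1+n≢n) (trans B₁.right (cong suc (sym (update-same h _ _))))))
    ; raised = trans (B.others (suc j) (≢-sym K≢J)) (trans B₁.raised (cong (suc ∘ suc) (sym (update-same h _ _))))
    ; others = λ m m≢J → sym (update-other h _ _ m m≢J)
    }
    where
    module B₁ = BoxN B₁
    module B  = BoxN B
    K₁ : h₀ (suc k) ≡ h₁ (suc k)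
    K₁ = B₁.others (suc k) K≢J
    lowered-agrees : ∀ m → m ≢ suc k → update h (suc j) (h₁ (suc j)) m ≡ h₁ m
    lowered-agrees m m≢K with m ≟ suc j
    ... | yes refl = update-same h _ _
    ... | no m≢J = trans (update-other h _ _ m m≢J) (trans (B.others m m≢K) (B₁.others m m≢J))

module _ where
  open ≡
  open import Data.Nat.Properties using (+-comm; <-irrefl)
  open import Data.Integer as ℤ using (∣_∣; +<+) renaming (_+_ to _+ℤ_; _<_ to _<ℤ_)
  open import Data.Bool using (true; false)

  heightN : Diagram → ℕ → ℕ
  heightN a m = ∣ height a m ∣

  -- all heights of a are ≥ 0 (true for every ξ′_a, see xiPrime-built)
  NonNegative : Diagram → Set
  NonNegative a = ∀ m → height a m ≡ ℤ.+ heightN a m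

  private
    step-±1 : ∀ a j → (step a j ≡ ℤ.+ 1) ⊎ (step a j ≡ ℤ.- (ℤ.+ 1))
    step-±1 a j with pt a j
    ... | nothing = inj₁ refl
    ... | just k with j ℕ.<ᵇ k
    ...   | true  = inj₁ refl
    ...   | false = inj₂ refl

    +-injective : ∀ {u w} → ℤ.+ u ≡ ℤ.+ w → u ≡ w
    +-injective refl = refl

    <ℤ⇒< : ∀ {x y X Y} → x ≡ ℤ.+ X → y ≡ ℤ.+ Y → x <ℤ y → X < Y
    <ℤ⇒< refl refl (+<+ p) = p

    Adjacent : ℕ → ℕ → Set
    Adjacent X Y = (Y ≡ suc X) ⊎ (X ≡ suc Y)

    up : ∀ {X Y} → Adjacent X Y → X < Y → Y ≡ suc X
    up (inj₁ e) _ = e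
    up (inj₂ refl) lt = ⊥-elim (<-irrefl refl (≤-trans (n≤1+n _) lt))

    down : ∀ {X Y} → Adjacent X Y → Y < X → X ≡ suc Y
    down (inj₁ refl) lt = ⊥-elim (<-irrefl refl (≤-trans (n≤1+n _) lt))
    down (inj₂ e) _ = e

  heights-adjacent : ∀ a → NonNegative a → ∀ m → Adjacent (heightN a m) (heightN a (suc m))
  heights-adjacent a nn m with step-±1 a (suc m)
  ... | inj₁ s = inj₁ (trans (+-injective (trans (sym (nn (suc m))) (cong₂ _+ℤ_ (nn m) s))) (+-comm _ 1))
  ... | inj₂ s = inj₂ (go (heightN a m) (trans (sym (nn (suc m))) (cong₂ _+ℤ_ (nn m) s)))
    where
    go : ∀ X → ℤ.+ heightN a (suc m) ≡ ℤ.+ X +ℤ ℤ.- (ℤ.+ 1) → X ≡ suc (heightN a (suc m))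
    go zero    ()
    go (suc X) refl = refl

  slopeAt⇒SlopeN : ∀ a j → NonNegative a → SlopeAt a (suc j) → SlopeN (heightN a) j
  slopeAt⇒SlopeN a j nn (inj₁ (l₁ , l₂)) =
    inj₁ (up (heights-adjacent a nn j) (<ℤ⇒< (nn j) (nn (suc j)) l₁) ,
          up (heights-adjacent a nn (suc j)) (<ℤ⇒< (nn (suc j)) (nn (suc (suc j))) l₂))
  slopeAt⇒SlopeN a j nn (inj₂ (l₁ , l₂)) =
    inj₂ (down (heights-adjacent a nn j) (<ℤ⇒< (nn (suc j)) (nn j) l₂) ,
          down (heights-adjacent a nn (suc j)) (<ℤ⇒< (nn (suc (suc j))) (nn (suc j)) l₁))

  boxAdd⇒BoxN : ∀ {n} a b j → NonNegative a → BoxAdd n (suc j) a b → NonNegative b × BoxN (heightN a) j (heightN b)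
  boxAdd⇒BoxN a b j nn (_ , _ , (min₁ , min₂) , _ , raised , others) = nn-b , record
    { left   = down (heights-adjacent a nn j) (<ℤ⇒< (nn (suc j)) (nn j) min₁)
    ; right  = up (heights-adjacent a nn (suc j)) (<ℤ⇒< (nn (suc j)) (nn (suc (suc j))) min₂)
    ; raised = cong ∣_∣ raised′
    ; others = λ m ne → cong ∣_∣ (others m ne)
    }
    where
    raised′ : height b (suc j) ≡ ℤ.+ suc (suc (heightN a (suc j)))
    raised′ = trans raised (trans (cong (_+ℤ ℤ.+ 2) (nn (suc j))) (cong ℤ.+_ (+-comm _ 2)))
    nn-b : NonNegative b
    nn-b m with m ≟ suc j
    ... | yes refl = trans raised′ (cong ℤ.+_ (sym (cong ∣_∣ raised′)))
    ... | no ne = trans (others m ne) (trans (nn m) (cong ℤ.+_ (sym (cong ∣_∣ (others m ne)))))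

  minimal-nonNegative : ∀ p n → 2 ℕ.* p ≤ n → NonNegative (minimal p n)
  minimal-nonNegative p n 2p≤n m =
    trans (height-minimal p n 2p≤n m) (cong (ℤ.+_ ∘ ∣_∣) (sym (height-minimal p n 2p≤n m)))

  heightN-minimal : ∀ p n → 2 ℕ.* p ≤ n → ∀ m → heightN (minimal p n) m ≡ minimalHeight p m
  heightN-minimal p n 2p≤n m = cong ∣_∣ (height-minimal p n 2p≤n m)

module Slopes {c ℓ : Level} (F : Field c ℓ) (q : Field.Carrier F) (n p : ℕ) (2p≤n : 2 ℕ.* p ≤ n) where
  open Field F using (Carrier; _≈_; 0#; 1#; _+_; _*_; -_)
  open TL F q
  open Action F q
  open Linear F q
  open Identities F q
  open ≡
  open import Data.Nat.Properties using (0≢1+n)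

  ξmin : LC
  ξmin = (1# , minimal p n) ∷ []

  -- Built d h v: v is ξ′ of the half-diagram with (natural-number) heights h
  -- reached from the minimal element by d box additions
  data Built : ℕ → (ℕ → ℕ) → LC → Set c where
    base : ∀ {h} → (∀ m → h m ≡ minimalHeight p m) → Built 0 h ξmin
    box  : ∀ {d h h′ v} k → Built d h v → suc (suc k) ≤ n → BoxN h k h′ →
           Built (suc d) h′ (eMinus (suc k) (μ (suc (h (suc k)))) v)

  built-wellPaired : ∀ {d h v} → Built d h v → AllWellPaired n v
  built-wellPaired (base _) = minimal-wellPaired p n 2p≤n All.∷ All.[]
  built-wellPaired (box {v = v} k V k<n _) = eMinus-wellPaired (suc k) _ v (s≤s z≤n) k<n (built-wellPaired V)

  -- heights never exceed the position; this keeps all μ_k used with k ≤ n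
  built-height-≤ : ∀ {d h v} → Built d h v → ∀ m → h m ≤ m
  built-height-≤ (base eq) m = subst (_≤ m) (sym (eq m)) (minimalHeight-≤ p m)
  built-height-≤ (box k V _ B) m with m ≟ suc k
  ... | yes refl = subst (_≤ suc k) (sym (trans (BoxN.raised B) (cong suc (sym (BoxN.left B)))))
                         (s≤s (built-height-≤ V k))
  ... | no m≢K = subst (_≤ m) (sym (BoxN.others B m m≢K)) (built-height-≤ V m)

  base-peak-low : ∀ {h j x} → (∀ m → h m ≡ minimalHeight p m) → PeakN h j x → x ≡ 0
  base-peak-low {j = j} {x} eq P = minimal-peak-height p j x top left right
    where open PeakN (peak-transfer {g = minimalHeight p} (eq j) (eq (suc j)) (eq (suc (suc j))) P)

  -- At a peak of height one, e_{j+1} v = q v: the peak comes from a cup of the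
  -- minimal element that no later box touches.
  peak₁-eigen : ∀ {d h v} → Built d h v → ∀ j → suc (suc j) ≤ n → PeakN h j 0 → eAct (suc j) v ≋ scale q v
  peak₁-eigen (base eq) j j<n P =
    ≡⇒≋ (e-onCup (minimal-wellPaired p n 2p≤n) (minimal-peak-cup p n j 2p≤n top left right) 1#)
    where open PeakN (peak-transfer {g = minimalHeight p} (eq j) (eq (suc j)) (eq (suc (suc j))) P)
  peak₁-eigen (box k V k<n B) j j<n P with position k j
  ... | at      = ⊥-elim (0≢1+n (peak-unique P (peak-of-box B)))
  ... | toRight = ⊥-elim (adjacent-peaks P (peak-of-box B))
  ... | toLeft  = ⊥-elim (adjacent-peaks (peak-of-box B) P)
  ... | apart K≢J K≢sJ J≢sK =
    distant-eigen (suc j) (suc k) _ _ (s≤s z≤n) j<n (s≤s z≤n) k<n (≢-sym K≢J) J≢sK K≢sJ (built-wellPaired V)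
      (peak₁-eigen V j j<n (peak-apart B K≢J K≢sJ J≢sK P))

  record LastBox (d : ℕ) (h : ℕ → ℕ) (v : LC) (j : ℕ) : Set (c ⊔ ℓ) where
    constructor lastBox
    field
      {h₁}      : ℕ → ℕ
      {v₁}      : LC
      built     : Built d h₁ v₁
      lastStep  : BoxN h₁ j h
      expansion : v ≋ eMinus (suc j) (μ (suc (h₁ (suc j)))) v₁

  -- Exchange lemma: a peak of height ≥ 2 can always be taken to be the last
  -- box added, since boxes at distant positions commute.
  mutual
    exchange : ∀ d {h v} → Built (suc d) h v → ∀ j {m} → suc (suc j) ≤ n → PeakN h j (suc m) → LastBox d h v j
    exchange d (box k V k<n B) j j<n P with position k j
    ... | at      = lastBox V B (λ _ → Field.refl F)
    ... | toRight = ⊥-elim (adjacent-peaks P (peak-of-box B))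
    ... | toLeft  = ⊥-elim (adjacent-peaks (peak-of-box B) P)
    ... | apart K≢J K≢sJ J≢sK = exchange-past d V k<n B K≢J K≢sJ J≢sK j<n (peak-apart B K≢J K≢sJ J≢sK P)

    exchange-past : ∀ d {h₀ v₀ h k j m} → Built d h₀ v₀ → suc (suc k) ≤ n → BoxN h₀ k h →
                    suc k ≢ suc j → suc k ≢ suc (suc j) → suc j ≢ suc (suc k) →
                    suc (suc j) ≤ n → PeakN h₀ j (suc m) →
                    LastBox d h (eMinus (suc k) (μ (suc (h₀ (suc k)))) v₀) j
    exchange-past zero (base eq) _ _ _ _ _ _ P = ⊥-elim (0≢1+n (sym (base-peak-low eq P)))
    exchange-past (suc d) {h₀} {v₀} {h} {k} {j} V k<n B K≢J K≢sJ J≢sK j<n P with exchange d V j j<n P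
    ... | lastBox {h₁} {v₁} V₁ B₁ expansion =
      lastBox (box k V₁ k<n (proj₁ swapped)) (proj₂ swapped) reordered
      where
      swapped : BoxN h₁ k (update h (suc j) (h₁ (suc j))) × BoxN (update h (suc j) (h₁ (suc j))) j h
      swapped = boxes-commute B₁ B K≢J K≢sJ J≢sK
      μK μJ : Carrier
      μK = μ (suc (h₀ (suc k)))
      μJ = μ (suc (h₁ (suc j)))
      reordered : eMinus (suc k) μK v₀ ≋
                  eMinus (suc j) (μ (suc (update h (suc j) (h₁ (suc j)) (suc j)))) (eMinus (suc k) (μ (suc (h₁ (suc k)))) v₁)
      reordered b = Field.trans F (eMinus-cong (suc k) μK {v₀} {eMinus (suc j) μJ v₁} expansion b)
        (Field.trans F (eMinus-commute (suc k) (suc j) μK μJ (s≤s z≤n) k<n (s≤s z≤n) j<n K≢J K≢sJ J≢sK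
                                       v₁ (built-wellPaired V₁) b)
          (≡⇒≋ (cong₂ (λ s t → eMinus (suc j) (μ (suc s)) (eMinus (suc k) (μ (suc t)) v₁))
                      (sym (update-same h (suc j) (h₁ (suc j)))) (BoxN.others B₁ (suc k) K≢J)) b))

  xiPrime-built : ∀ {a v} → XiPrime n p a v → NonNegative a × Σ ℕ λ d → Built d (heightN a) v
  xiPrime-built base = minimal-nonNegative p n 2p≤n , 0 , base (heightN-minimal p n 2p≤n)
  xiPrime-built (box {a} {b} .(suc j) X A@(s≤s {n = j} z≤n , j<n , _)) with xiPrime-built X
  ... | nn , d , V with boxAdd⇒BoxN a b j nn A
  ...   | nn-b , B = nn-b , suc d , box j V j<n B

  -- A box at j+1 itself is impossible (it creates a peak); a box
  -- far from j+1 commutes with e_{j+1}; a box next to j+1 sits beside a peak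
  -- of the previous heights, handled by peak-next-to-box.
  module _ (Δ≉0 : ∀ k → k ≤ n → ¬ (Δ k ≈ 0#)) where
    mutual
      slope-kills : ∀ d {h v} → Built d h v → ∀ j → suc (suc j) ≤ n → SlopeN h j → eAct (suc j) v ≋ []
      slope-kills zero {h} (base eq) j j<n s =
        ≡⇒≋ (trans (eAct-singleton (suc j) 1# (minimal p n))
                   (eBasis-through-through (minimal p n) (suc j) 1# (proj₁ through) (proj₂ through)))
        where
        through : (pt (minimal p n) (suc j) ≡ nothing) × (pt (minimal p n) (suc (suc j)) ≡ nothing)
        through = minimal-slope-through p n j 2p≤n
                    (slope-transfer {h} {minimalHeight p} (eq j) (eq (suc j)) (eq (suc (suc j))) s)
      slope-kills (suc d) (box k V k<n B) j j<n s with position k j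
      ... | at = ⊥-elim (peak-not-slope (peak-of-box B) s)
      ... | toRight =
        peak-next-to-box d V j j<n (slope-right-of-box B s) (suc j) k<n
          (zigzag↓ (suc j) (s≤s z≤n) k<n) (lowered-slope-right B)
      ... | toLeft =
        peak-next-to-box d V (suc k) j<n (slope-left-of-box B s) k k<n
          (zigzag↑ (suc k) (s≤s z≤n) j<n) (lowered-slope-left B)
      ... | apart K≢J K≢sJ J≢sK =
        distant-kills (suc j) (suc k) _ _ (s≤s z≤n) j<n (s≤s z≤n) k<n (≢-sym K≢J) J≢sK K≢sJ (built-wellPaired V)
          (slope-kills d V j j<n (slope-apart B K≢J K≢sJ J≢sK s))

      peak-next-to-box : ∀ d {h₀ v₀} → Built d h₀ v₀ → ∀ j → suc (suc j) ≤ n → ∀ {x} → PeakN h₀ j x →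
                         ∀ jB → suc (suc jB) ≤ n →
                         (∀ w → AllWellPaired n w → eAct (suc j) (eAct (suc jB) (eAct (suc j) w)) ≡ eAct (suc j) w) →
                         (∀ {h₁} → BoxN h₁ j h₀ → SlopeN h₁ jB) →
                         eAct (suc j) (eMinus (suc jB) (μ (suc x)) v₀) ≋ []
      peak-next-to-box d {v₀ = v₀} V j j<n {zero} P jB _ zigzag _ =
        adjacent-peak₁ (suc j) (suc jB) v₀ (Δ≉0 1 (≤-trans (s≤s z≤n) j<n)) (zigzag _ (built-wellPaired V))
          (peak₁-eigen V j j<n P)
      peak-next-to-box zero (base eq) j j<n {suc x} P _ _ _ _ = ⊥-elim (0≢1+n (sym (base-peak-low eq P)))
      peak-next-to-box (suc d) {h₀} {v₀} V j j<n {suc x} P jB jB<n zigzag lowering with exchange d V j j<n P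
      ... | lastBox {h₁} {v₁} V₁ B₁ expansion =
        adjacent-peak (suc j) (suc jB) _ (μ (suc (suc x))) v₀ v₁ (zigzag v₁ W₁) (idempotent (suc j) (s≤s z≤n) j<n v₁ W₁)
          (slope-kills d V₁ jB jB<n (lowering B₁)) expansion
          (subst (λ t → μ (suc (suc x)) * (q + - μ (suc t)) ≈ 1#) (sym lowered)
                 (μ-recurrence x (Δ≉0 (suc x) (≤-trans (n≤1+n _) top≤n)) (Δ≉0 (suc (suc x)) top≤n)))
        where
        W₁ : AllWellPaired n v₁
        W₁ = built-wellPaired V₁
        lowered : h₁ (suc j) ≡ x
        lowered = suc-injective (suc-injective (trans (sym (BoxN.raised B₁)) (PeakN.top P)))
        top≤n : suc (suc x) ≤ n
        top≤n = ≤-trans (subst (_≤ suc j) (PeakN.top P) (built-height-≤ V (suc j))) (≤-trans (n≤1+n _) j<n)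

mainTheorem5 : ∀ {c ℓ : Level} (F : Field c ℓ) (q : Field.Carrier F) (n p : ℕ) →
    2 ℕ.* p ≤ n →
    (∀ k → k ≤ n → ¬ (Field._≈_ F (TL.Δ F q k) (Field.0# F))) →
    (a : Diagram) (v : TL.LC F q) → TL.XiPrime F q n p a v →
    (i : ℕ) → 1 ≤ i → i < n → SlopeAt a i →
    TL.IsZero F q (TL.eAct F q i v)
mainTheorem5 F q n p 2p≤n Δ≉0 a v X .(suc j) (s≤s {n = j} z≤n) i<n slope
  with Slopes.xiPrime-built F q n p 2p≤n X
... | nn , d , V = Slopes.slope-kills F q n p 2p≤n Δ≉0 d V j i<n (slopeAt⇒SlopeN a j nn slope)
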